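{- Let $R$ be a relation on $H$, $Q$ a relation on $N$, and $C$ a decisive, $R$-anonymous and $Q$-neutral social preference correspondence. Then the following are equivalent: (i) $C$ admits an $R$-anonymous and $Q$-neutral resolute refinement; (ii) $\gcd\big(\gamma(\mathrm{Aut}(R)),|\mathrm{Aut}(Q)|\big)=1$.
   Context: Let $n,h\ge 2$ be integers, $N=\{1,\dots,n\}$ (alternatives), $H=\{1,\dots,h\}$ (individuals). $S_m$ is the symmetric group on $\{1,\dots,m\}$ with product $(\sigma\tau)(x)=\sigma(\tau(x))$. $\mathbf{L}(N)$ is the set of linear orders on $N$; a linear order $q$ with $q(1)\succ q(2)\succ\dots\succ q(n)$ is identified with the permutation $r\mapsto q(r)$ (alternative of rank $r$) in $S_n$. Let $\rho_0\in S_n$, $\rho_0(r)=n-r+1$, $\Omega=\{id,\rho_0\}$. For $\sigma\in S_n$ and a set $X$ of linear orders, $\sigma X=\{\sigma q:q\in X\}$ (products of permutations). The set of preference profiles is $\mathcal{P}=\mathbf{L}(N)^h$. Let $G=S_h\times S_n\times\Omega$ (componentwise product); for $(\varphi,\psi,\rho)\in G$ and $p\in\mathcal P$, $p^{(\varphi,\psi,\rho)}$ is the profile whose $i$-th component is $\psi p_{\varphi^{ -1}(i)}\rho$. A social preference correspondence (SPC) is a map $C$ assigning to each $p\in\mathcal P$ a subset $C(p)\subseteq\mathbf L(N)$. $C$ is decisive if $C(p)\neq\emptyset$ for all $p$, resolute if $|C(p)|=1$ for all $p$; $C'$ is a refinement of $C$ if $C'(p)\subseteq C(p)$ for all $p$.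 For $U\le G$, $C$ is $U$-consistent if for all $p\in\mathcal P$ and $(\varphi,\psi,\rho)\in U$: $C(p^{(\varphi,\psi,\rho)})=\psi C(p)$ if $\rho=id$, and $C(p^{(\varphi,\psi,\rho)})\neq\psi C(p)$ if $\rho=\rho_0$ and $|C(p)|=1$. For a relation $R\subseteq\{1,\dots,m\}^2$, $\mathrm{Aut}(R)=\{\sigma\in S_m:\forall x,y,\ (\sigma(x),\sigma(y))\in R\iff (x,y)\in R\}$. $C$ is $R$-anonymous (for $R$ a relation on $H$) if it is $\mathrm{Aut}(R)\times\{id\}\times\{id\}$-consistent, and $Q$-neutral (for $Q$ a relation on $N$) if it is $\{id\}\times\mathrm{Aut}(Q)\times\{id\}$-consistent. For $\sigma\in S_m$, the type $T(\sigma)$ is the multiset of sizes of the orbits of $\sigma$ on $\{1,\dots,m\}$ (fixed points counted as orbits of size 1); for $U\le S_m$, the type number is $\gamma(U)=\mathrm{lcm}\{\gcd(T(\sigma)):\sigma\in U\}$. -}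

module Defs where

open import Data.Nat using (ℕ; zero; suc)
open import Data.Nat.GCD using (gcd)
open import Data.Nat.LCM using (lcm)
open import Data.Bool using (Bool; T)
import Data.Bool as Bool
open import Data.Fin using (Fin; zero; suc; opposite; _≟_)
open import Data.Fin.Properties using (all?; any?; opposite-involutive)
open import Data.Vec using (Vec; []; _∷_; lookup; tabulate; allFin)
open import Data.Vec.Properties using (lookup∘tabulate)
open import Data.List using (List; [_]; concatMap; map; foldr; filter; length)
import Data.Vec as Vec
open import Data.Maybe using (Maybe; just; nothing; fromMaybe)
import Data.Maybe as Maybe
open import Data.Product using (Σ; ∃; _×_; _,_)
open import Relation.Binary.PropositionalEquality using (_≡_; refl; cong; trans; sym)
open import Relation.Nullary using (¬_; Dec; yes; no)
open import Relation.Nullary.Decidable using (_→-dec_; _×-dec_)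
open import Function using (_∘_; id)

-- Permutations of {1..m}, modelled on Fin m (0-based), as the vector of
-- images (σ(0),…,σ(m-1)) together with an (irrelevant) proof of
-- injectivity (= bijectivity on a finite set).

record Perm (m : ℕ) : Set where
  constructor mkPerm
  field
    vec  : Vec (Fin m) m
    .inj : ∀ i j → lookup vec i ≡ lookup vec j → i ≡ j
open Perm public

app : ∀ {m} → Perm m → Fin m → Fin m
app σ = lookup (vec σ)

idPerm : ∀ {m} → Perm m
idPerm {m} = mkPerm (tabulate id) λ i j e →
  trans (sym (lookup∘tabulate id i)) (trans e (lookup∘tabulate id j))

_·_ : ∀ {m} → Perm m → Perm m → Perm m
mkPerm s is · mkPerm t it =
  mkPerm (tabulate (λ x → lookup s (lookup t x))) λ i j e →
    it i j (is _ _
      (trans (sym (lookup∘tabulate (λ x → lookup s (lookup t x)) i))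
        (trans e (lookup∘tabulate (λ x → lookup s (lookup t x)) j))))

position : ∀ {m k} → Vec (Fin m) k → Fin m → Maybe (Fin k)
position [] x = nothing
position (y ∷ ys) x with y ≟ x
... | yes _ = just zero
... | no  _ = Maybe.map suc (position ys x)

inv : ∀ {m} → Perm m → Fin m → Fin m
inv σ x = fromMaybe x (position (vec σ) x)

-- Linear orders on N = Fin n, identified with permutations r ↦ q(r)
-- (alternative of rank r).  ρ₀(r) = n - r + 1 is `opposite`.

LO : ℕ → Set
LO = Perm

ρ₀ : ∀ {n} → Perm n
ρ₀ {n} = mkPerm (tabulate opposite) λ i j e →
  trans (sym (opposite-involutive i))
   (trans (cong opposite
     (trans (sym (lookup∘tabulate opposite i))
       (trans e (lookup∘tabulate opposite j))))
     (opposite-involutive j))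

data Ω : Set where
  ωid ωρ₀ : Ω

⟦_⟧Ω : ∀ {n} → Ω → Perm n
⟦ ωid ⟧Ω = idPerm
⟦ ωρ₀ ⟧Ω = ρ₀

Profile : ℕ → ℕ → Set
Profile n h = Vec (LO n) h

G : ℕ → ℕ → Set
G n h = Perm h × Perm n × Ω

act : ∀ {n h} → Profile n h → G n h → Profile n h
act p (φ , ψ , ρ) = tabulate λ i → ψ · (lookup p (inv φ i) · ⟦ ρ ⟧Ω)

SPC : ℕ → ℕ → Set
SPC n h = Profile n h → LO n → Bool

_∈_ : ∀ {n} → LO n → (LO n → Bool) → Set
q ∈ X = T (X q)

SetEqImage : ∀ {n} → (LO n → Bool) → Perm n → (LO n → Bool) → Set
SetEqImage X ψ Y =
  (∀ q → q ∈ X → ∃ λ q' → q' ∈ Y × q ≡ ψ · q') ×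
  (∀ q' → q' ∈ Y → (ψ · q') ∈ X)

Singleton : ∀ {n} → (LO n → Bool) → Set
Singleton X = ∃ λ q → q ∈ X × (∀ q' → q' ∈ X → q' ≡ q)

Decisive : ∀ {n h} → SPC n h → Set
Decisive C = ∀ p → ∃ λ q → q ∈ C p

Resolute : ∀ {n h} → SPC n h → Set
Resolute C = ∀ p → Singleton (C p)

Refinement : ∀ {n h} → SPC n h → SPC n h → Set
Refinement C' C = ∀ p q → q ∈ C' p → q ∈ C p

Consistent : ∀ {n h} → (G n h → Set) → SPC n h → Set
Consistent {n} {h} U C = ∀ (p : Profile n h) (g : G n h) → U g → Clause p g
  where
  Clause : Profile n h → G n h → Set
  Clause p (φ , ψ , ωid) = SetEqImage (C (act p (φ , ψ , ωid))) ψ (C p)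
  Clause p (φ , ψ , ωρ₀) =
    Singleton (C p) → ¬ SetEqImage (C (act p (φ , ψ , ωρ₀))) ψ (C p)

Relation : ℕ → Set
Relation m = Fin m → Fin m → Bool

InAut : ∀ {m} → Relation m → (Fin m → Fin m) → Set
InAut R σ = ∀ x y → R (σ x) (σ y) ≡ R x y

Anonymous : ∀ {n h} → Relation h → SPC n h → Set
Anonymous R = Consistent (λ { (φ , ψ , ρ) → InAut R (app φ) × ψ ≡ idPerm × ρ ≡ ωid })

Neutral : ∀ {n h} → Relation n → SPC n h → Set
Neutral Q = Consistent (λ { (φ , ψ , ρ) → φ ≡ idPerm × InAut Q (app ψ) × ρ ≡ ωid })

allVecs : (k m : ℕ) → List (Vec (Fin m) k)
allVecs zero m = [ [] ]
allVecs (suc k) m = concatMap (λ v → Data.List.map (_∷ v) (Vec.toList (allFin m))) (allVecs k m)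

injective? : ∀ {m} (v : Vec (Fin m) m) → Dec (∀ i j → lookup v i ≡ lookup v j → i ≡ j)
injective? v = all? λ i → all? λ j → (lookup v i ≟ lookup v j) →-dec (i ≟ j)

inAut? : ∀ {m} (R : Relation m) (σ : Fin m → Fin m) → Dec (InAut R σ)
inAut? R σ = all? λ x → all? λ y → R (σ x) (σ y) Bool.≟ R x y

-- the elements of Aut(R) ≤ S_m, each listed exactly once
AutList : ∀ {m} → Relation m → List (Vec (Fin m) m)
AutList {m} R = filter (λ v → injective? v ×-dec inAut? R (lookup v)) (allVecs m m)

orderAut : ∀ {m} → Relation m → ℕ
orderAut R = length (AutList R)

iter : ∀ {A : Set} → (A → A) → ℕ → A → A
iter f zero x = x
iter f (suc k) x = f (iter f k x)

-- size of the orbit of x under σ : |{ σ^k x : k ∈ ℕ }| = |{ σ^k x : k < m }|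
orbitSize : ∀ {m} → (Fin m → Fin m) → Fin m → ℕ
orbitSize {m} σ x =
  length (filter (λ y → any? (λ (k : Fin m) → iter σ (Data.Fin.toℕ k) x ≟ y))
                 (Vec.toList (allFin m)))

-- gcd(T(σ)): gcd of orbit sizes (over all points; same set of values as
-- over the orbits)
gcdType : ∀ {m} → (Fin m → Fin m) → ℕ
gcdType {m} σ = foldr gcd 0 (map (orbitSize σ) (Vec.toList (allFin m)))

typeNumberAut : ∀ {m} → Relation m → ℕ
typeNumberAut R = foldr lcm 1 (map (λ v → gcdType (lookup v)) (AutList R))

module Submission where

-- Both directions study the action x ↦ x ⟪ φ , ψ ⟫ of Aut(R) × Aut(Q) on
-- profiles and its stabilisers.  If (φ, ψ) fixes a profile, ψ raised to any
-- orbit size of φ fixes a linear order, so ψ^gcd(T(φ)) = 1; conversely, if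
-- ψᵖ = 1 and p divides all orbit sizes of φ, a fixed profile can be built.
-- Necessity: a common prime p of γ(Aut R) and |Aut Q| yields φ with
-- p ∣ gcd(T(φ)) and, by Cauchy's theorem (McKay's necklace proof), ψ of order
-- p; at a profile fixed by (φ, ψ) a consistent resolute C′ would need ψ q = q.
-- Sufficiency: under coprimality every stabiliser has trivial Aut(Q)-part, as
-- a prime-order power of ψ would make p divide both numbers.  So choosing an
-- order of C at a canonical representative of each orbit and transporting it
-- back along the (unique) ψ gives a well-defined equivariant refinement.

open import Defs
open import Data.Nat as ℕ using (ℕ; zero; suc; _+_; _*_; _∸_; _≤_; _<_; z≤n; s≤s; NonZero; _%_; _/_; _^_)
open import Data.Nat.Properties hiding (_≟_)
open import Data.Fin using (Fin; zero; suc; _≟_; punchOut; toℕ; fromℕ<)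
open import Data.Fin.Properties using (any?; punchOut-injective; injective⇒≤; pigeonhole; toℕ<n; toℕ-fromℕ<; toℕ-injective)
open import Data.Vec as Vec using (Vec; []; _∷_; lookup; tabulate; allFin)
open import Data.Vec.Properties using (lookup∘tabulate; tabulate∘lookup; tabulate-cong; length-toList)
import Data.Vec.Properties as VecP
open import Data.List as L using (List; []; _∷_; [_]; _++_; length; filter; concatMap; replicate; foldr; cartesianProduct)
open import Data.List.Membership.Propositional using (find; lose) renaming (_∈_ to _∈L_)
open import Data.List.Membership.Propositional.Properties using (∈-filter⁺; ∈-filter⁻; ∈-allFin; ∈-tabulate⁺; ∈-tabulate⁻; ∈-map⁺; ∈-map⁻; ∈-concatMap⁺; ∈-concatMap⁻; ∈-cartesianProduct⁺; ∈-cartesianProduct⁻)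
open import Data.List.Properties using (filter-notAll; length-tabulate; length-map; length-++; length-replicate; map-∘; map-id-local; ++-assoc; ++-identityʳ; ∷-injective; ∷-injectiveʳ; ≡-dec)
open import Data.List.Relation.Unary.All as All using (All; []; _∷_)
import Data.List.Relation.Unary.All.Properties as AllP
open import Data.List.Relation.Unary.Any as Any using (Any; here; there)
open import Data.List.Relation.Unary.AllPairs as AllPairs using () renaming ([] to []ᵘ; _∷_ to _∷ᵘ_)
import Data.List.Relation.Unary.AllPairs.Properties as AllPairsP
open import Data.List.Relation.Binary.Disjoint.Propositional using (Disjoint)
open import Data.List.Relation.Unary.Unique.Propositional using (Unique)
import Data.List.Relation.Unary.Unique.Propositional.Properties as UP
open import Data.Nat.Induction using (<-rec)
open import Data.Maybe using (just; nothing)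
open import Data.Nat.DivMod using (m≡m%n+[m/n]*n; m%n<n)
open import Data.Nat.Divisibility using (_∣_; divides; ∣-refl; ∣-trans; ∣m∣n⇒∣m+n; ∣m+n∣m⇒∣n; ∣m⇒∣m*n; ∣1⇒≡1; 0∣⇒≡0; m∣m*n; n∣m*n; m%n≡0⇒n∣m)
open import Data.Nat.Primality using (Prime; prime⇒nonZero; prime⇒nonTrivial; euclidsLemma)
open import Data.Nat.Primality.Factorisation using (factorise)
open import Data.Nat.LCM using (lcm; m∣lcm[m,n]; n∣lcm[m,n]; lcm-least)
open import Data.Nat.Coprimality using (prime⇒coprime; coprime⇒gcd≡1)
open import Data.Nat.GCD using (gcd; gcd-GCD; module Bézout; gcd[m,n]∣m; gcd[m,n]∣n; gcd-greatest; gcd[m,n]≢0)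
open import Data.Bool as Bool using (Bool)
open import Data.Product using (Σ; ∃; _×_; _,_; proj₁; proj₂)
open import Data.Empty using (⊥; ⊥-elim)
open import Data.Sum using (inj₁; inj₂)
open import Relation.Binary.PropositionalEquality hiding ([_])
open import Relation.Binary.Definitions using (DecidableEquality; tri<; tri≈; tri>)
open import Relation.Nullary using (¬_; Dec; yes; no; ¬?)
open import Relation.Nullary.Decidable using (recompute; _×-dec_; decidable-stable; ⌊_⌋; toWitness; fromWitness; T?)
open import Function using (_∘_; id; case_of_)
open import Function.Bundles using (_⇔_; mk⇔)

vec-ext : ∀ {A : Set} {m} {v w : Vec A m} → (∀ x → lookup v x ≡ lookup w x) → v ≡ w
vec-ext {v = v} {w} h = trans (sym (tabulate∘lookup v)) (trans (tabulate-cong h) (tabulate∘lookup w))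

perm-ext : ∀ {m} {σ τ : Perm m} → (∀ x → app σ x ≡ app τ x) → σ ≡ τ
perm-ext {σ = mkPerm v _} {mkPerm w _} h = mk≡ (vec-ext h)
  where
  mk≡ : ∀ {v w} .{i j} → v ≡ w → mkPerm v i ≡ mkPerm w j
  mk≡ refl = refl

_≟P_ : ∀ {m} → DecidableEquality (Perm m)
σ ≟P τ with VecP.≡-dec _≟_ (vec σ) (vec τ)
... | yes e = yes (perm-ext λ x → cong (λ v → lookup v x) e)
... | no ne = no λ e → ne (cong vec e)

perm-injective : ∀ {m} (σ : Perm m) x y → app σ x ≡ app σ y → x ≡ y
perm-injective (mkPerm v iv) x y e = recompute (x ≟ y) (iv x y e)

app-· : ∀ {m} (σ τ : Perm m) x → app (σ · τ) x ≡ app σ (app τ x)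
app-· σ τ x = lookup∘tabulate (λ y → app σ (app τ y)) x

app-id : ∀ {m} x → app (idPerm {m}) x ≡ x
app-id x = lookup∘tabulate id x

-- An injective endomap of a finite set is surjective (otherwise it would
-- inject Fin (suc k) into Fin k).
injective⇒surjective : ∀ {m} (f : Fin m → Fin m) → (∀ x y → f x ≡ f y → x ≡ y) →
  ∀ y → ∃ λ x → f x ≡ y
injective⇒surjective {suc k} f f-inj y with any? (λ x → f x ≟ y)
... | yes found = found
... | no ¬found = ⊥-elim (<-irrefl refl (injective⇒≤ {f = g} g-inj))
  where
  miss : ∀ x → y ≢ f x
  miss x e = ¬found (x , sym e)
  g : Fin (suc k) → Fin k
  g x = punchOut (miss x)
  g-inj : ∀ {a b} → g a ≡ g b → a ≡ b
  g-inj {a} {b} e = f-inj a b (punchOut-injective (miss a) (miss b) e)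

position-just : ∀ {m k} (v : Vec (Fin m) k) x i → position v x ≡ just i → lookup v i ≡ x
position-just (y ∷ v) x i e with y ≟ x
position-just (y ∷ v) x .zero refl | yes y≡x = y≡x
position-just (y ∷ v) x i e | no _ with position v x in eq
position-just (y ∷ v) x .(suc j) refl | no _ | just j = position-just v x j eq

position-nothing : ∀ {m k} (v : Vec (Fin m) k) x → position v x ≡ nothing → ∀ i → lookup v i ≢ x
position-nothing (y ∷ v) x e i with y ≟ x
position-nothing (y ∷ v) x () i | yes _
position-nothing (y ∷ v) x e i | no y≢x with position v x in eq
position-nothing (y ∷ v) x e zero | no y≢x | nothing = y≢x
position-nothing (y ∷ v) x e (suc i) | no y≢x | nothing = position-nothing v x eq i

inv-r : ∀ {m} (σ : Perm m) x → app σ (inv σ x) ≡ x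
inv-r σ x with position (vec σ) x in eq
... | just i = position-just (vec σ) x i eq
... | nothing = ⊥-elim (position-nothing (vec σ) x eq (proj₁ pre) (proj₂ pre))
  where pre = injective⇒surjective (app σ) (perm-injective σ) x

inv-l : ∀ {m} (σ : Perm m) x → inv σ (app σ x) ≡ x
inv-l σ x = perm-injective σ _ _ (inv-r σ (app σ x))

invP : ∀ {m} → Perm m → Perm m
invP σ = mkPerm (tabulate (inv σ)) λ i j e →
  trans (sym (inv-r σ i)) (trans (cong (app σ)
    (trans (sym (lookup∘tabulate (inv σ) i)) (trans e (lookup∘tabulate (inv σ) j)))) (inv-r σ j))

app-invP : ∀ {m} (σ : Perm m) x → app (invP σ) x ≡ inv σ x
app-invP σ x = lookup∘tabulate (inv σ) x

module _ {m : ℕ} where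

  ·-assoc : (a b c : Perm m) → (a · b) · c ≡ a · (b · c)
  ·-assoc a b c = perm-ext λ x → begin
    app ((a · b) · c) x   ≡⟨ app-· (a · b) c x ⟩
    app (a · b) (app c x) ≡⟨ app-· a b (app c x) ⟩
    app a (app b (app c x)) ≡⟨ cong (app a) (sym (app-· b c x)) ⟩
    app a (app (b · c) x) ≡⟨ sym (app-· a (b · c) x) ⟩
    app (a · (b · c)) x   ∎ where open ≡-Reasoning

  ·-identityˡ : (a : Perm m) → idPerm · a ≡ a
  ·-identityˡ a = perm-ext λ x → trans (app-· idPerm a x) (app-id _)

  ·-identityʳ : (a : Perm m) → a · idPerm ≡ a
  ·-identityʳ a = perm-ext λ x → trans (app-· a idPerm x) (cong (app a) (app-id x))

  ·-inverseˡ : (a : Perm m) → invP a · a ≡ idPerm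
  ·-inverseˡ a = perm-ext λ x →
    trans (app-· (invP a) a x) (trans (app-invP a _) (trans (inv-l a x) (sym (app-id x))))

  ·-inverseʳ : (a : Perm m) → a · invP a ≡ idPerm
  ·-inverseʳ a = perm-ext λ x →
    trans (app-· a (invP a) x) (trans (cong (app a) (app-invP a x)) (trans (inv-r a x) (sym (app-id x))))

  inverse-unique : (a b : Perm m) → a · b ≡ idPerm → a ≡ invP b
  inverse-unique a b e = begin
    a                       ≡⟨ sym (·-identityʳ a) ⟩
    a · idPerm              ≡⟨ cong (a ·_) (sym (·-inverseʳ b)) ⟩
    a · (b · invP b)        ≡⟨ sym (·-assoc a b (invP b)) ⟩
    (a · b) · invP b        ≡⟨ cong (_· invP b) e ⟩
    idPerm · invP b         ≡⟨ ·-identityˡ _ ⟩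
    invP b                  ∎ where open ≡-Reasoning

  invP-·≡id⇒≡ : (a b : Perm m) → invP b · a ≡ idPerm → a ≡ b
  invP-·≡id⇒≡ a b e = begin
    a                  ≡⟨ sym (·-identityˡ a) ⟩
    idPerm · a         ≡⟨ cong (_· a) (sym (·-inverseʳ b)) ⟩
    (b · invP b) · a   ≡⟨ ·-assoc b (invP b) a ⟩
    b · (invP b · a)   ≡⟨ cong (b ·_) e ⟩
    b · idPerm         ≡⟨ ·-identityʳ b ⟩
    b                  ∎ where open ≡-Reasoning

  ·-inverse-swap : (a b : Perm m) → a · b ≡ idPerm → b · a ≡ idPerm
  ·-inverse-swap a b e = trans (cong (b ·_) (inverse-unique a b e)) (·-inverseʳ b)

  ·-cancel-id : (a q : Perm m) → a · q ≡ q → a ≡ idPerm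
  ·-cancel-id a q e = begin
    a                  ≡⟨ sym (·-identityʳ a) ⟩
    a · idPerm         ≡⟨ cong (a ·_) (sym (·-inverseʳ q)) ⟩
    a · (q · invP q)   ≡⟨ sym (·-assoc a q (invP q)) ⟩
    (a · q) · invP q   ≡⟨ cong (_· invP q) e ⟩
    q · invP q         ≡⟨ ·-inverseʳ q ⟩
    idPerm             ∎ where open ≡-Reasoning

  inv-· : (a b : Perm m) (i : Fin m) → inv (a · b) i ≡ inv b (inv a i)
  inv-· a b i = perm-injective (a · b) _ _ (begin
    app (a · b) (inv (a · b) i)        ≡⟨ inv-r (a · b) i ⟩
    i                                  ≡⟨ sym (inv-r a i) ⟩
    app a (inv a i)                    ≡⟨ cong (app a) (sym (inv-r b (inv a i))) ⟩
    app a (app b (inv b (inv a i)))    ≡⟨ sym (app-· a b _) ⟩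
    app (a · b) (inv b (inv a i))      ∎) where open ≡-Reasoning

  invP-· : (a b : Perm m) → invP (a · b) ≡ invP b · invP a
  invP-· a b = sym (inverse-unique (invP b · invP a) (a · b) (begin
    (invP b · invP a) · (a · b) ≡⟨ ·-assoc (invP b) (invP a) (a · b) ⟩
    invP b · (invP a · (a · b)) ≡⟨ cong (invP b ·_) (sym (·-assoc (invP a) a b)) ⟩
    invP b · ((invP a · a) · b) ≡⟨ cong (λ z → invP b · (z · b)) (·-inverseˡ a) ⟩
    invP b · (idPerm · b)       ≡⟨ cong (invP b ·_) (·-identityˡ b) ⟩
    invP b · b                  ≡⟨ ·-inverseˡ b ⟩
    idPerm                      ∎))
    where open ≡-Reasoning

  invP-shift : (b ψ : Perm m) → invP b ≡ ψ · invP (b · ψ)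
  invP-shift b ψ = sym (begin
    ψ · invP (b · ψ)         ≡⟨ cong (ψ ·_) (invP-· b ψ) ⟩
    ψ · (invP ψ · invP b)    ≡⟨ sym (·-assoc ψ (invP ψ) (invP b)) ⟩
    (ψ · invP ψ) · invP b    ≡⟨ cong (_· invP b) (·-inverseʳ ψ) ⟩
    idPerm · invP b          ≡⟨ ·-identityˡ (invP b) ⟩
    invP b                   ∎)
    where open ≡-Reasoning

module _ {A : Set} (f : A → A) where

  iter-+ : ∀ a b x → iter f (a + b) x ≡ iter f a (iter f b x)
  iter-+ zero b x = refl
  iter-+ (suc a) b x = cong f (iter-+ a b x)

  iter-suc : ∀ a x → iter f (suc a) x ≡ iter f a (f x)
  iter-suc a x = trans (cong (λ k → iter f k x) (+-comm 1 a)) (iter-+ a 1 x)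

  iter-fixed : ∀ {x} → f x ≡ x → ∀ k → iter f k x ≡ x
  iter-fixed e zero = refl
  iter-fixed e (suc k) = trans (cong f (iter-fixed e k)) e

  iter-* : ∀ {a x} → iter f a x ≡ x → ∀ k → iter f (k * a) x ≡ x
  iter-* e zero = refl
  iter-* {a} {x} e (suc k) = trans (iter-+ a (k * a) x) (trans (cong (iter f a) (iter-* e k)) e)

  iter-combination : ∀ a b d u v {x} → iter f a x ≡ x → iter f b x ≡ x → d + v * b ≡ u * a →
    iter f d x ≡ x
  iter-combination a b d u v {x} ea eb eq = begin
    iter f d x                    ≡⟨ cong (iter f d) (sym (iter-* eb v)) ⟩
    iter f d (iter f (v * b) x)   ≡⟨ sym (iter-+ d (v * b) x) ⟩
    iter f (d + v * b) x          ≡⟨ cong (λ k → iter f k x) eq ⟩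
    iter f (u * a) x              ≡⟨ iter-* ea u ⟩
    x                             ∎ where open ≡-Reasoning

  iter-gcd : ∀ a b {x} → iter f a x ≡ x → iter f b x ≡ x → iter f (gcd a b) x ≡ x
  iter-gcd a b ea eb with Bézout.identity (gcd-GCD a b)
  ... | Bézout.+- u v eq = iter-combination a b (gcd a b) u v ea eb eq
  ... | Bézout.-+ u v eq = iter-combination b a (gcd a b) v u eb ea eq

  iter-mod : ∀ {p x} .{{_ : NonZero p}} → iter f p x ≡ x → ∀ a → iter f a x ≡ iter f (a % p) x
  iter-mod {p} {x} e a = begin
    iter f a x                               ≡⟨ cong (λ k → iter f k x) (m≡m%n+[m/n]*n a p) ⟩
    iter f (a % p + (a / p) * p) x           ≡⟨ iter-+ (a % p) _ x ⟩
    iter f (a % p) (iter f ((a / p) * p) x)  ≡⟨ cong (iter f (a % p)) (iter-* e (a / p)) ⟩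
    iter f (a % p) x                         ∎ where open ≡-Reasoning

  module _ (f-inj : ∀ y z → f y ≡ f z → y ≡ z) where

    iter-cancel : ∀ k {y z} → iter f k y ≡ iter f k z → y ≡ z
    iter-cancel zero e = e
    iter-cancel (suc k) e = iter-cancel k (f-inj _ _ e)

    iter-∸ : ∀ {a b x} → b ≤ a → iter f a x ≡ iter f b x → iter f (a ∸ b) x ≡ x
    iter-∸ {a} {b} {x} b≤a e = iter-cancel b (begin
      iter f b (iter f (a ∸ b) x) ≡⟨ sym (iter-+ b (a ∸ b) x) ⟩
      iter f (b + (a ∸ b)) x      ≡⟨ cong (λ k → iter f k x) (m+[n∸m]≡n b≤a) ⟩
      iter f a x                  ≡⟨ e ⟩
      iter f b x                  ∎)
      where open ≡-Reasoning

module Counting {X : Set} (_≟X_ : DecidableEquality X) where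

  ⊆⇒length≤ : ∀ {xs ys : List X} → Unique xs → (∀ {z} → z ∈L xs → z ∈L ys) → length xs ≤ length ys
  ⊆⇒length≤ {[]} _ _ = z≤n
  ⊆⇒length≤ {x ∷ xs} {ys} (x∉xs ∷ᵘ xs!) xs⊆ys = ≤-trans (s≤s (⊆⇒length≤ xs! xs⊆ys-x)) shorter
    where
    ¬x? : ∀ z → Dec (z ≢ x)
    ¬x? z = ¬? (z ≟X x)
    xs⊆ys-x : ∀ {z} → z ∈L xs → z ∈L filter ¬x? ys
    xs⊆ys-x z∈ = ∈-filter⁺ ¬x? (xs⊆ys (there z∈)) λ e → All.lookup x∉xs z∈ (sym e)
    shorter : suc (length (filter ¬x? ys)) ≤ length ys
    shorter = filter-notAll ¬x? ys (Any.map (λ e ne → ne (sym e)) (xs⊆ys (here refl)))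

  same-elements⇒same-length : ∀ {xs ys : List X} → Unique xs → Unique ys →
    (∀ {z} → z ∈L xs → z ∈L ys) → (∀ {z} → z ∈L ys → z ∈L xs) → length xs ≡ length ys
  same-elements⇒same-length xs! ys! xs⊆ys ys⊆xs = ≤-antisym (⊆⇒length≤ xs! xs⊆ys) (⊆⇒length≤ ys! ys⊆xs)

  length-split : ∀ {P : X → Set} (P? : ∀ x → Dec (P x)) xs →
    length xs ≡ length (filter P? xs) + length (filter (λ x → ¬? (P? x)) xs)
  length-split P? [] = refl
  length-split P? (x ∷ xs) with P? x
  ... | yes _ = cong suc (length-split P? xs)
  ... | no _ = trans (cong suc (length-split P? xs)) (sym (+-suc _ _))

allFinL : (m : ℕ) → List (Fin m)
allFinL m = Vec.toList (allFin m)

allFinL≡allFin : ∀ m → allFinL m ≡ L.allFin m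
allFinL≡allFin m = toList-tabulate m id
  where
  toList-tabulate : ∀ {A : Set} n (f : Fin n → A) → Vec.toList (tabulate f) ≡ L.tabulate f
  toList-tabulate zero f = refl
  toList-tabulate (suc n) f = cong (f zero ∷_) (toList-tabulate n (f ∘ suc))

allFinL-complete : ∀ {m} (x : Fin m) → x ∈L allFinL m
allFinL-complete {m} x = subst (x ∈L_) (sym (allFinL≡allFin m)) (∈-allFin x)

allFinL-unique : ∀ m → Unique (allFinL m)
allFinL-unique m = subst Unique (sym (allFinL≡allFin m)) (UP.allFin⁺ m)

tuples : ∀ {A : Set} → List A → (k : ℕ) → List (Vec A k)
tuples xs zero = [ [] ]
tuples xs (suc k) = concatMap (λ v → L.map (_∷ v) xs) (tuples xs k)

module _ {A : Set} (xs : List A) where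

  private
    extend : ∀ {k} → Vec A k → List (Vec A (suc k))
    extend v = L.map (_∷ v) xs

  ∈-tuples⁺ : ∀ {k} (v : Vec A k) → All (_∈L xs) (Vec.toList v) → v ∈L tuples xs k
  ∈-tuples⁺ [] [] = here refl
  ∈-tuples⁺ (a ∷ v) (a∈ ∷ v∈) = ∈-concatMap⁺ extend (Any.map (λ { refl → ∈-map⁺ (_∷ v) a∈ }) (∈-tuples⁺ v v∈))

  ∈-tuples⁻ : ∀ {k} (v : Vec A k) → v ∈L tuples xs k → All (_∈L xs) (Vec.toList v)
  ∈-tuples⁻ [] _ = []
  ∈-tuples⁻ {suc k} (a ∷ v) v∈ with find (∈-concatMap⁻ extend {xs = tuples xs k} v∈)
  ... | w , w∈ , a∷v∈ with ∈-map⁻ (_∷ w) a∷v∈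
  ... | b , b∈ , refl = b∈ ∷ ∈-tuples⁻ w w∈

  tuples-unique : Unique xs → ∀ k → Unique (tuples xs k)
  tuples-unique xs! zero = [] ∷ᵘ []ᵘ
  tuples-unique xs! (suc k) = UP.concat⁺ (AllP.map⁺ (All.universal (λ v → UP.map⁺ (proj₁ ∘ VecP.∷-injective) xs!) _))
    (AllPairsP.map⁺ (AllPairs.map disjoint (tuples-unique xs! k)))
    where
    disjoint : ∀ {v w} → v ≢ w → Disjoint (L.map (_∷ v) xs) (L.map (_∷ w) xs)
    disjoint v≢w (u∈ , u∈′) with ∈-map⁻ (_∷ _) u∈ | ∈-map⁻ (_∷ _) u∈′
    ... | _ , _ , refl | _ , _ , e = v≢w (proj₂ (VecP.∷-injective e))

  length-tuples : ∀ k → length (tuples xs k) ≡ length xs ^ k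
  length-tuples zero = refl
  length-tuples (suc k) = begin
    length (tuples xs (suc k))          ≡⟨ length-concatMap (tuples xs k) ⟩
    length (tuples xs k) * length xs    ≡⟨ cong (_* length xs) (length-tuples k) ⟩
    length xs ^ k * length xs           ≡⟨ *-comm _ (length xs) ⟩
    length xs ^ suc k                   ∎
    where
    open ≡-Reasoning
    length-concatMap : ∀ vs → length (concatMap (λ v → L.map (_∷ v) xs) vs) ≡ length vs * length xs
    length-concatMap [] = refl
    length-concatMap (v ∷ vs) = trans (length-++ (L.map (_∷ v) xs))
      (cong₂ _+_ (length-map (_∷ v) xs) (length-concatMap vs))

allVecs≡tuples : ∀ k m → allVecs k m ≡ tuples (allFinL m) k
allVecs≡tuples zero m = refl
allVecs≡tuples (suc k) m = cong (concatMap (λ v → L.map (_∷ v) (allFinL m))) (allVecs≡tuples k m)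

rotate : ∀ {A : Set} → List A → List A
rotate [] = []
rotate (a ∷ t) = t ++ [ a ]

module _ {A : Set} where

  length-rotate : (xs : List A) → length (rotate xs) ≡ length xs
  length-rotate [] = refl
  length-rotate (a ∷ t) = trans (length-++ t) (+-comm (length t) 1)

  rotate-++ : (xs ys : List A) → iter rotate (length xs) (xs ++ ys) ≡ ys ++ xs
  rotate-++ [] ys = sym (++-identityʳ ys)
  rotate-++ (x ∷ xs) ys = begin
    iter rotate (suc (length xs)) (x ∷ xs ++ ys)  ≡⟨ iter-suc rotate (length xs) _ ⟩
    iter rotate (length xs) ((xs ++ ys) ++ [ x ]) ≡⟨ cong (iter rotate (length xs)) (++-assoc xs ys [ x ]) ⟩
    iter rotate (length xs) (xs ++ (ys ++ [ x ])) ≡⟨ rotate-++ xs (ys ++ [ x ]) ⟩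
    (ys ++ [ x ]) ++ xs                           ≡⟨ ++-assoc ys [ x ] xs ⟩
    ys ++ x ∷ xs                                  ∎ where open ≡-Reasoning

  rotate-length : (xs : List A) → iter rotate (length xs) xs ≡ xs
  rotate-length xs = trans (cong (iter rotate (length xs)) (sym (++-identityʳ xs))) (rotate-++ xs [])

  rotate-replicate : (a : A) (k : ℕ) → rotate (replicate k a) ≡ replicate k a
  rotate-replicate a zero = refl
  rotate-replicate a (suc k) = snoc-replicate k
    where
    snoc-replicate : ∀ k → replicate k a ++ [ a ] ≡ a ∷ replicate k a
    snoc-replicate zero = refl
    snoc-replicate (suc k) = cong (a ∷_) (snoc-replicate k)

  rotate-fixed : (a : A) (t : List A) → rotate (a ∷ t) ≡ a ∷ t → t ≡ replicate (length t) a
  rotate-fixed a [] e = refl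
  rotate-fixed a (b ∷ t) e with ∷-injective e
  ... | refl , e′ = cong (a ∷_) (rotate-fixed a t e′)

first : ∀ {A : Set} {P : A → Set} → (∀ a → Dec (P a)) → List A → A → A
first P? [] d = d
first P? (a ∷ as) d with P? a
... | yes _ = a
... | no _ = first P? as d

first-satisfies : ∀ {A : Set} {P : A → Set} (P? : ∀ a → Dec (P a)) xs d {a} → a ∈L xs → P a →
  P (first P? xs d)
first-satisfies P? (x ∷ xs) d a∈ pa with P? x
... | yes px = px
first-satisfies P? (x ∷ xs) d (here refl) pa | no ¬px = ⊥-elim (¬px pa)
first-satisfies P? (x ∷ xs) d (there a∈) pa | no ¬px = first-satisfies P? xs d a∈ pa

first-cong : ∀ {A : Set} {P Q : A → Set} (P? : ∀ a → Dec (P a)) (Q? : ∀ a → Dec (Q a)) →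
  (∀ a → P a → Q a) → (∀ a → Q a → P a) → ∀ xs d d′ {a} → a ∈L xs → P a → first P? xs d ≡ first Q? xs d′
first-cong P? Q? P⇒Q Q⇒P (x ∷ xs) d d′ a∈ pa with P? x | Q? x
... | yes _ | yes _ = refl
... | yes px | no ¬qx = ⊥-elim (¬qx (P⇒Q x px))
... | no ¬px | yes qx = ⊥-elim (¬px (Q⇒P x qx))
first-cong P? Q? P⇒Q Q⇒P (x ∷ xs) d d′ (here refl) pa | no ¬px | no _ = ⊥-elim (¬px pa)
first-cong P? Q? P⇒Q Q⇒P (x ∷ xs) d d′ (there a∈) pa | no _ | no _ = first-cong P? Q? P⇒Q Q⇒P xs d d′ a∈ pa

module Canonical {A : Set} (all : List A) (complete : ∀ a → a ∈L all)
  (_~_ : A → A → Set) (_~?_ : ∀ a b → Dec (a ~ b))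
  (~-refl : ∀ {a} → a ~ a) (~-sym : ∀ {a b} → a ~ b → b ~ a) (~-trans : ∀ {a b c} → a ~ b → b ~ c → a ~ c) where

  -- Opaque, so that the search through `all` is never unfolded during type checking.
  opaque
    canon : A → A
    canon a = first (a ~?_) all a

    canon-related : ∀ a → a ~ canon a
    canon-related a = first-satisfies (a ~?_) all a (complete a) ~-refl

    canon-cong : ∀ {a b} → a ~ b → canon a ≡ canon b
    canon-cong {a} {b} a~b = first-cong (a ~?_) (b ~?_) (λ c a~c → ~-trans (~-sym a~b) a~c)
      (λ c b~c → ~-trans a~b b~c) all a b (complete a) ~-refl

least : ∀ {P : ℕ → Set} → (∀ k → Dec (P k)) → ∀ n → P n → ∃ λ k → P k × (∀ j → j < k → ¬ P j)
least P? zero p = 0 , p , λ j ()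
least P? (suc n) p with P? 0
... | yes p0 = 0 , p0 , λ j ()
... | no ¬p0 with least (λ k → P? (suc k)) n p
... | k , pk , below = suc k , pk , λ { zero _ → ¬p0 ; (suc j) (s≤s j<k) → below j j<k }

module Period {m} (f : Fin m → Fin m) (f-inj : ∀ a b → f a ≡ f b → a ≡ b) (x : Fin m) where

  -- Pigeonhole among x, f x, …, fᵐ x gives a positive return time.
  private
    some-return : ∃ λ k → iter f (suc k) x ≡ x
    some-return with pigeonhole (n<1+n m) (λ (k : Fin (suc m)) → iter f (toℕ k) x)
    ... | i , j , i<j , e = ℕ.pred (toℕ j ∸ toℕ i) ,
      trans (cong (λ k → iter f k x) (suc-pred (toℕ j ∸ toℕ i) {{ℕ.>-nonZero (m<n⇒0<n∸m i<j)}}))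
            (iter-∸ f f-inj (<⇒≤ i<j) (sym e))

    minimal : ∃ λ k → iter f (suc k) x ≡ x × (∀ j → j < k → iter f (suc j) x ≢ x)
    minimal = least (λ k → iter f (suc k) x ≟ x) (proj₁ some-return) (proj₂ some-return)

  period : ℕ
  period = suc (proj₁ minimal)

  instance
    period-nonZero : NonZero period
    period-nonZero = _

  period-returns : iter f period x ≡ x
  period-returns = proj₁ (proj₂ minimal)

  below-period : ∀ k → k < period → iter f k x ≡ x → k ≡ 0
  below-period zero _ _ = refl
  below-period (suc k) (s≤s k<) e = ⊥-elim (proj₂ (proj₂ minimal) k k< e)

  iter-mod-period : ∀ a → iter f a x ≡ iter f (a % period) x
  iter-mod-period = iter-mod f period-returns

  period-∣ : ∀ k → iter f k x ≡ x → period ∣ k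
  period-∣ k e = m%n≡0⇒n∣m k period (below-period (k % period) (m%n<n k period)
    (trans (sym (iter-mod-period k)) e))

  private
    no-gap : ∀ (a b : Fin period) → toℕ a ≤ toℕ b → iter f (toℕ b) x ≡ iter f (toℕ a) x → toℕ b ≤ toℕ a
    no-gap a b a≤b e = m∸n≡0⇒m≤n
      (below-period (toℕ b ∸ toℕ a) (≤-<-trans (m∸n≤m (toℕ b) (toℕ a)) (toℕ<n b)) (iter-∸ f f-inj a≤b e))

  orbit-injective : ∀ (a b : Fin period) → iter f (toℕ a) x ≡ iter f (toℕ b) x → a ≡ b
  orbit-injective a b e with ≤-total (toℕ a) (toℕ b)
  ... | inj₁ a≤b = toℕ-injective (≤-antisym a≤b (no-gap a b a≤b (sym e)))
  ... | inj₂ b≤a = toℕ-injective (≤-antisym (no-gap b a b≤a e) b≤a)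
  period≤m : period ≤ m
  period≤m = injective⇒≤ {f = λ (k : Fin period) → iter f (toℕ k) x} (orbit-injective _ _)

  orbit-point : Fin period → Fin m
  orbit-point k = iter f (toℕ k) x

  orbit : List (Fin m)
  orbit = L.tabulate orbit-point

  ∈-orbit : ∀ a → iter f a x ∈L orbit
  ∈-orbit a = subst (_∈L orbit) (sym (iter-mod-period a))
    (subst (λ t → iter f t x ∈L orbit) (toℕ-fromℕ< a%p<p) (∈-tabulate⁺ {f = orbit-point} (fromℕ< a%p<p)))
    where
    a%p<p : a % period < period
    a%p<p = m%n<n a period

  orbitSize≡period : orbitSize f x ≡ period
  orbitSize≡period = trans
    (same-elements⇒same-length (UP.filter⁺ reached? (allFinL-unique m)) (UP.tabulate⁺ (orbit-injective _ _))
       reached⇒orbit orbit⇒reached)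
    (length-tabulate orbit-point)
    where
    open Counting _≟_
    reached? : ∀ y → Dec (∃ λ (k : Fin m) → iter f (toℕ k) x ≡ y)
    reached? y = any? (λ k → iter f (toℕ k) x ≟ y)
    reached⇒orbit : ∀ {y} → y ∈L filter reached? (allFinL m) → y ∈L orbit
    reached⇒orbit y∈ with ∈-filter⁻ reached? {xs = allFinL m} y∈
    ... | _ , (k , refl) = ∈-orbit (toℕ k)
    orbit⇒reached : ∀ {y} → y ∈L orbit → y ∈L filter reached? (allFinL m)
    orbit⇒reached y∈ with ∈-tabulate⁻ {f = orbit-point} y∈
    ... | k , refl = ∈-filter⁺ reached? (allFinL-complete _)
      (fromℕ< k<m , cong (λ t → iter f t x) (toℕ-fromℕ< k<m))
      where
      k<m : toℕ k < m
      k<m = <-≤-trans (toℕ<n k) period≤m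

-- y is in the orbit of x under f.  Writing the exponent as an element of
-- Fin m loses nothing (periods are at most m) and makes the relation
-- decidable; it is an equivalence relation.
module Orbits {m} (f : Fin m → Fin m) (f-inj : ∀ a b → f a ≡ f b → a ≡ b) where

  Reach : Fin m → Fin m → Set
  Reach x y = ∃ λ (k : Fin m) → iter f (toℕ k) x ≡ y

  reach? : ∀ x y → Dec (Reach x y)
  reach? x y = any? (λ k → iter f (toℕ k) x ≟ y)

  reach : ∀ {x y} k → iter f k x ≡ y → Reach x y
  reach {x} k e = fromℕ< k%p<m , trans (cong (λ t → iter f t x) (toℕ-fromℕ< k%p<m)) (trans (sym (iter-mod-period k)) e)
    where
    open Period f f-inj x
    k%p<m : k % period < m
    k%p<m = <-≤-trans (m%n<n k period) period≤m

  reach-refl : ∀ {x} → Reach x x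
  reach-refl = reach 0 refl

  reach-trans : ∀ {x y z} → Reach x y → Reach y z → Reach x z
  reach-trans {x} (k , refl) (l , refl) = reach (toℕ l + toℕ k) (iter-+ f (toℕ l) (toℕ k) x)

  -- Going around the orbit of x k times, f^(k·period - k) brings fᵏ x back to x.
  reach-sym : ∀ {x y} → Reach x y → Reach y x
  reach-sym {x} (k , refl) = reach (K * period ∸ K) (begin
    iter f (K * period ∸ K) (iter f K x)  ≡⟨ sym (iter-+ f (K * period ∸ K) K x) ⟩
    iter f (K * period ∸ K + K) x         ≡⟨ cong (λ t → iter f t x) (m∸n+n≡m (m≤m*n K period)) ⟩
    iter f (K * period) x                 ≡⟨ iter-* f period-returns K ⟩
    x                                     ∎)
    where
    open Period f f-inj x
    open ≡-Reasoning
    K : ℕ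
    K = toℕ k

pw : ∀ {m} → Perm m → ℕ → Perm m
pw a k = iter (a ·_) k idPerm

module _ {m : ℕ} where

  iter-·≡pw : (a : Perm m) (k : ℕ) (z : Perm m) → iter (a ·_) k z ≡ pw a k · z
  iter-·≡pw a zero z = sym (·-identityˡ z)
  iter-·≡pw a (suc k) z = trans (cong (a ·_) (iter-·≡pw a k z)) (sym (·-assoc a (pw a k) z))

  pw-+ : (a : Perm m) (i j : ℕ) → pw a (i + j) ≡ pw a i · pw a j
  pw-+ a i j = trans (iter-+ (a ·_) i j idPerm) (iter-·≡pw a i (pw a j))

  pw-* : (a : Perm m) (i j : ℕ) → pw (pw a i) j ≡ pw a (j * i)
  pw-* a i zero = refl
  pw-* a i (suc j) = trans (cong (pw a i ·_) (pw-* a i j)) (sym (pw-+ a i (j * i)))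

module _ {m : ℕ} (R : Relation m) where

  aut-· : (a b : Perm m) → InAut R (app a) → InAut R (app b) → InAut R (app (a · b))
  aut-· a b a∈ b∈ x y rewrite app-· a b x | app-· a b y = trans (a∈ _ _) (b∈ x y)

  aut-id : InAut R (app (idPerm {m}))
  aut-id x y rewrite app-id x | app-id y = refl

  aut-invP : (a : Perm m) → InAut R (app a) → InAut R (app (invP a))
  aut-invP a a∈ x y rewrite app-invP a x | app-invP a y =
    trans (sym (a∈ _ _)) (cong₂ R (inv-r a x) (inv-r a y))

  aut-pw : (a : Perm m) → InAut R (app a) → (k : ℕ) → InAut R (app (pw a k))
  aut-pw a a∈ zero = aut-id
  aut-pw a a∈ (suc k) = aut-· a (pw a k) a∈ (aut-pw a a∈ k)

-- A vector of images read as a permutation (the identity if it is not injective).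
toPerm : ∀ {m} → Vec (Fin m) m → Perm m
toPerm v with injective? v
... | yes v-inj = mkPerm v v-inj
... | no _ = idPerm

toPerm-vec : ∀ {m} (σ : Perm m) → toPerm (vec σ) ≡ σ
toPerm-vec σ with injective? (vec σ)
... | yes _ = refl
... | no ¬inj = ⊥-elim (¬inj (perm-injective σ))

vec-toPerm : ∀ {m} (v : Vec (Fin m) m) → (∀ i j → lookup v i ≡ lookup v j → i ≡ j) → vec (toPerm v) ≡ v
vec-toPerm v v-inj with injective? v
... | yes _ = refl
... | no ¬inj = ⊥-elim (¬inj v-inj)

module _ {m : ℕ} (R : Relation m) where

  private
    isAut? : (v : Vec (Fin m) m) → Dec _
    isAut? v = injective? v ×-dec inAut? R (lookup v)

  ∈-allVecs : (v : Vec (Fin m) m) → v ∈L allVecs m m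
  ∈-allVecs v = subst (v ∈L_) (sym (allVecs≡tuples m m))
    (∈-tuples⁺ (allFinL m) v (All.tabulate (λ _ → allFinL-complete _)))

  vec∈AutList : (σ : Perm m) → InAut R (app σ) → vec σ ∈L AutList R
  vec∈AutList σ σ∈ = ∈-filter⁺ isAut? (∈-allVecs (vec σ)) (perm-injective σ , σ∈)

  AutList-sound : ∀ {v} → v ∈L AutList R → vec (toPerm v) ≡ v × InAut R (app (toPerm v))
  AutList-sound {v} v∈ with ∈-filter⁻ isAut? {xs = allVecs m m} v∈
  ... | _ , v-inj , v-aut = vec-toPerm v v-inj , subst (λ w → InAut R (lookup w)) (sym (vec-toPerm v v-inj)) v-aut

  autPerms : List (Perm m)
  autPerms = L.map toPerm (AutList R)

  length-autPerms : length autPerms ≡ orderAut R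
  length-autPerms = length-map toPerm (AutList R)

  ∈-autPerms⁺ : (σ : Perm m) → InAut R (app σ) → σ ∈L autPerms
  ∈-autPerms⁺ σ σ∈ = subst (_∈L autPerms) (toPerm-vec σ) (∈-map⁺ toPerm (vec∈AutList σ σ∈))

  ∈-autPerms⁻ : ∀ {σ} → σ ∈L autPerms → InAut R (app σ)
  ∈-autPerms⁻ σ∈ with ∈-map⁻ toPerm σ∈
  ... | v , v∈ , refl = proj₂ (AutList-sound v∈)

  autPerms-unique : Unique autPerms
  autPerms-unique = UP.map⁻ {f = vec} (subst Unique (sym vecs≡AutList)
    (UP.filter⁺ isAut? (subst Unique (sym (allVecs≡tuples m m)) (tuples-unique _ (allFinL-unique m) m))))
    where
    vecs≡AutList : L.map vec autPerms ≡ AutList R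
    vecs≡AutList = trans (sym (map-∘ (AutList R)))
      (map-id-local (All.tabulate λ v∈ → proj₁ (AutList-sound v∈)))

prime-factor : ∀ n → 2 ≤ n → ∃ λ p → Prime p × p ∣ n
prime-factor n@(suc _) 2≤n with factorise n
... | record { factors = [] ; isFactorisation = n≡1 } = ⊥-elim (<-irrefl (sym n≡1) 2≤n)
... | record { factors = p ∷ _ ; isFactorisation = n≡ ; factorsPrime = p-prime ∷ _ } =
  p , p-prime , subst (p ∣_) (sym n≡) (m∣m*n _)

module _ {B : Set} (g : B → ℕ) where

  gcd-fold-∣ : ∀ xs {x} → x ∈L xs → foldr gcd 0 (L.map g xs) ∣ g x
  gcd-fold-∣ (y ∷ xs) (here refl) = gcd[m,n]∣m (g y) _
  gcd-fold-∣ (y ∷ xs) (there x∈) = ∣-trans (gcd[m,n]∣n (g y) _) (gcd-fold-∣ xs x∈)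

  ∣-lcm-fold : ∀ xs {x} → x ∈L xs → g x ∣ foldr lcm 1 (L.map g xs)
  ∣-lcm-fold (y ∷ xs) (here refl) = m∣lcm[m,n] (g y) _
  ∣-lcm-fold (y ∷ xs) (there x∈) = ∣-trans (∣-lcm-fold xs x∈) (n∣lcm[m,n] (g y) _)

  -- A prime dividing an lcm divides one of its arguments (lcm a b ∣ a·b).
  prime-∣-lcm-fold : ∀ xs {p} → Prime p → p ∣ foldr lcm 1 (L.map g xs) → ∃ λ x → x ∈L xs × p ∣ g x
  prime-∣-lcm-fold [] p-prime p∣1 = ⊥-elim (ℕ.nonTrivial⇒≢1 {{prime⇒nonTrivial p-prime}} (∣1⇒≡1 p∣1))
  prime-∣-lcm-fold (y ∷ xs) p-prime p∣ with euclidsLemma (g y) (foldr lcm 1 (L.map g xs)) p-prime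
    (∣-trans p∣ (lcm-least {g y} (m∣m*n _) (n∣m*n (g y))))
  ... | inj₁ p∣gy = y , here refl , p∣gy
  ... | inj₂ p∣rest = let (x , x∈ , p∣gx) = prime-∣-lcm-fold xs p-prime p∣rest in x , there x∈ , p∣gx

  iter-gcd-fold : ∀ {A : Set} (f : A → A) {z} xs → (∀ x → iter f (g x) z ≡ z) →
    iter f (foldr gcd 0 (L.map g xs)) z ≡ z
  iter-gcd-fold f [] returns = refl
  iter-gcd-fold f (x ∷ xs) returns = iter-gcd f (g x) _ (returns x) (iter-gcd-fold f xs returns)

module _ {m : ℕ} where

  gcdType∣orbitSize : (f : Fin m → Fin m) (x : Fin m) → gcdType f ∣ orbitSize f x
  gcdType∣orbitSize f x = gcd-fold-∣ (orbitSize f) (allFinL m) (allFinL-complete x)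

  gcdType-nonZero : (σ : Perm m) → Fin m → gcdType (app σ) ≢ 0
  gcdType-nonZero σ x gcd≡0 = ℕ.≢-nonZero⁻¹ period (trans (sym orbitSize≡period)
    (0∣⇒≡0 (subst (_∣ orbitSize (app σ) x) gcd≡0 (gcdType∣orbitSize (app σ) x))))
    where open Period (app σ) (perm-injective σ) x

  gcdType∣return : (σ : Perm m) (i : Fin m) (k : ℕ) → iter (app σ) k i ≡ i → gcdType (app σ) ∣ k
  gcdType∣return σ i k returns = ∣-trans (gcdType∣orbitSize (app σ) i)
    (subst (_∣ k) (sym orbitSize≡period) (period-∣ k returns))
    where open Period (app σ) (perm-injective σ) i

  gcdType∣typeNumber : (R : Relation m) (σ : Perm m) → InAut R (app σ) → gcdType (app σ) ∣ typeNumberAut R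
  gcdType∣typeNumber R σ σ∈ = ∣-lcm-fold (λ v → gcdType (lookup v)) (AutList R) (vec∈AutList R σ σ∈)

  prime∣typeNumber : (R : Relation m) {p : ℕ} → Prime p → p ∣ typeNumberAut R →
    ∃ λ σ → InAut R (app σ) × p ∣ gcdType (app σ)
  prime∣typeNumber R p-prime p∣ with prime-∣-lcm-fold (λ v → gcdType (lookup v)) (AutList R) p-prime p∣
  ... | v , v∈ , p∣gcd with AutList-sound R v∈
  ... | vec≡v , σ∈ = toPerm v , σ∈ , subst (λ w → _ ∣ gcdType (lookup w)) (sym vec≡v) p∣gcd

-- Free actions of a cyclic group of prime order

-- Let f map a duplicate-free list into itself, with fᵖ = id on it for a prime
-- p and without fixed points.  Then the list splits into f-orbits of size
-- exactly p, so p divides its length.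
module FreePrimeAction {X : Set} (_≟X_ : DecidableEquality X) (f : X → X) {p : ℕ} (p-prime : Prime p) where

  open Counting _≟X_
  open import Data.List.Membership.DecPropositional _≟X_ using (_∈?_)

  instance
    p-nonZero : NonZero p
    p-nonZero = prime⇒nonZero p-prime

  module Orbit {y : X} (y-period : iter f p y ≡ y) (y-moves : f y ≢ y) where

    no-early-return : ∀ k → 0 < k → k < p → iter f k y ≢ y
    no-early-return k@(suc _) _ k<p e = y-moves (subst (λ t → iter f t y ≡ y)
      (coprime⇒gcd≡1 (prime⇒coprime p-prime k<p)) (iter-gcd f p k y-period e))

    -- fᵃ y = fᵇ y with a < b < p would give the early return f^(p-b+a) y = y.
    distinct : ∀ a b → a < b → b < p → iter f a y ≢ iter f b y
    distinct a b a<b b<p e = no-early-return (p ∸ b + a)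
      (<-≤-trans (m<n⇒0<n∸m b<p) (m≤m+n (p ∸ b) a)) shorter returns
      where
      shorter : p ∸ b + a < p
      shorter = begin-strict
        p ∸ b + a  <⟨ +-monoʳ-< (p ∸ b) a<b ⟩
        p ∸ b + b  ≡⟨ m∸n+n≡m (<⇒≤ b<p) ⟩
        p          ∎ where open ≤-Reasoning
      returns : iter f (p ∸ b + a) y ≡ y
      returns = begin
        iter f (p ∸ b + a) y         ≡⟨ iter-+ f (p ∸ b) a y ⟩
        iter f (p ∸ b) (iter f a y)  ≡⟨ cong (iter f (p ∸ b)) e ⟩
        iter f (p ∸ b) (iter f b y)  ≡⟨ sym (iter-+ f (p ∸ b) b y) ⟩
        iter f (p ∸ b + b) y         ≡⟨ cong (λ t → iter f t y) (m∸n+n≡m (<⇒≤ b<p)) ⟩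
        iter f p y                   ≡⟨ y-period ⟩
        y                            ∎ where open ≡-Reasoning

    orbit-point : Fin p → X
    orbit-point k = iter f (toℕ k) y

    orbit : List X
    orbit = L.tabulate orbit-point

    orbit-unique : Unique orbit
    orbit-unique = UP.tabulate⁺ λ {a} {b} e → case <-cmp (toℕ a) (toℕ b) of λ where
      (tri< a<b _ _) → ⊥-elim (distinct _ _ a<b (toℕ<n b) e)
      (tri≈ _ a≡b _) → toℕ-injective a≡b
      (tri> _ _ b<a) → ⊥-elim (distinct _ _ b<a (toℕ<n a) (sym e))

    length-orbit : length orbit ≡ p
    length-orbit = length-tabulate orbit-point

    ∈-orbit : ∀ a → iter f a y ∈L orbit
    ∈-orbit a = subst (_∈L orbit) (sym (iter-mod f y-period a))
      (subst (λ t → iter f t y ∈L orbit) (toℕ-fromℕ< a%p<p) (∈-tabulate⁺ {f = orbit-point} (fromℕ< a%p<p)))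
      where
      a%p<p : a % p < p
      a%p<p = m%n<n a p

    -- The orbit is closed backwards: z = f^(p-1) (f z).
    orbit-back : ∀ {z} → iter f p z ≡ z → f z ∈L orbit → z ∈L orbit
    orbit-back {z} z-period fz∈ with ∈-tabulate⁻ {f = orbit-point} fz∈
    ... | k , fz≡ = subst (_∈L orbit) (sym z≡) (∈-orbit (p ∸ 1 + toℕ k))
      where
      open ≡-Reasoning
      z≡ : z ≡ iter f (p ∸ 1 + toℕ k) y
      z≡ = begin
        z                                  ≡⟨ sym z-period ⟩
        iter f p z                         ≡⟨ cong (λ t → iter f t z) (sym (m∸n+n≡m (ℕ.>-nonZero⁻¹ p))) ⟩
        iter f (p ∸ 1 + 1) z               ≡⟨ iter-+ f (p ∸ 1) 1 z ⟩
        iter f (p ∸ 1) (f z)               ≡⟨ cong (iter f (p ∸ 1)) fz≡ ⟩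
        iter f (p ∸ 1) (iter f (toℕ k) y)  ≡⟨ sym (iter-+ f (p ∸ 1) (toℕ k) y) ⟩
        iter f (p ∸ 1 + toℕ k) y           ∎

  record FreeOn (xs : List X) : Set where
    field
      unique   : Unique xs
      closed   : ∀ {y} → y ∈L xs → f y ∈L xs
      periodic : ∀ {y} → y ∈L xs → iter f p y ≡ y
      moves    : ∀ {y} → y ∈L xs → f y ≢ y

  module RemoveOrbit {xs} (free : FreeOn xs) {y} (y∈ : y ∈L xs) where
    open FreeOn free
    open Orbit (periodic y∈) (moves y∈)

    outside? : ∀ z → Dec (¬ (z ∈L orbit))
    outside? z = ¬? (z ∈? orbit)

    rest : List X
    rest = filter outside? xs

    orbit⊆xs : ∀ {z} → z ∈L orbit → z ∈L xs
    orbit⊆xs z∈ with ∈-tabulate⁻ {f = orbit-point} z∈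
    ... | k , refl = iter-closed (toℕ k)
      where
      iter-closed : ∀ k → iter f k y ∈L xs
      iter-closed zero = y∈
      iter-closed (suc k) = closed (iter-closed k)

    length-xs : length xs ≡ p + length rest
    length-xs = begin
      length xs                                          ≡⟨ length-split (_∈? orbit) xs ⟩
      length (filter (_∈? orbit) xs) + length rest       ≡⟨ cong (_+ length rest) inside≡orbit ⟩
      length orbit + length rest                         ≡⟨ cong (_+ length rest) length-orbit ⟩
      p + length rest                                    ∎
      where
      open ≡-Reasoning
      inside≡orbit : length (filter (_∈? orbit) xs) ≡ length orbit
      inside≡orbit = same-elements⇒same-length (UP.filter⁺ (_∈? orbit) unique) orbit-unique
        (λ z∈ → proj₂ (∈-filter⁻ (_∈? orbit) {xs = xs} z∈)) (λ z∈ → ∈-filter⁺ (_∈? orbit) (orbit⊆xs z∈) z∈)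

    rest-free : FreeOn rest
    rest-free = record
      { unique   = UP.filter⁺ outside? unique
      ; closed   = λ z∈ → let (z∈xs , z∉orbit) = ∈-filter⁻ outside? {xs = xs} z∈ in
                     ∈-filter⁺ outside? (closed z∈xs) (λ fz∈ → z∉orbit (orbit-back (periodic z∈xs) fz∈))
      ; periodic = λ z∈ → periodic (proj₁ (∈-filter⁻ outside? {xs = xs} z∈))
      ; moves    = λ z∈ → moves (proj₁ (∈-filter⁻ outside? {xs = xs} z∈))
      }

  p∣length : ∀ xs → FreeOn xs → p ∣ length xs
  p∣length xs = go (length xs) xs ≤-refl
    where
    go : ∀ n xs → length xs ≤ n → FreeOn xs → p ∣ length xs
    go _ [] _ _ = divides 0 refl
    go zero (_ ∷ _) () _
    go (suc n) xs@(_ ∷ _) xs≤ free =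
      subst (p ∣_) (sym length-xs) (∣m∣n⇒∣m+n ∣-refl (go n rest rest≤ rest-free))
      where
      open RemoveOrbit free (here refl)
      rest≤ : length rest ≤ n
      rest≤ = ≤-pred (≤-trans (subst (suc (length rest) ≤_) (sym length-xs)
        (+-monoˡ-≤ (length rest) (ℕ.>-nonZero⁻¹ p))) xs≤)

-- Finite groups of permutations and Cauchy's theorem

record FiniteGroup (m : ℕ) : Set where
  field
    elements   : List (Perm m)
    unique     : Unique elements
    ·-closed   : ∀ {a b} → a ∈L elements → b ∈L elements → a · b ∈L elements
    invP-closed : ∀ {a} → a ∈L elements → invP a ∈L elements
    id∈        : idPerm ∈L elements

  order : ℕ
  order = length elements

autGroup : ∀ {m} → Relation m → FiniteGroup m
autGroup R = record
  { elements    = autPerms R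
  ; unique      = autPerms-unique R
  ; ·-closed    = λ {a} {b} a∈ b∈ → ∈-autPerms⁺ R (a · b) (aut-· R a b (∈-autPerms⁻ R a∈) (∈-autPerms⁻ R b∈))
  ; invP-closed = λ {a} a∈ → ∈-autPerms⁺ R (invP a) (aut-invP R a (∈-autPerms⁻ R a∈))
  ; id∈         = ∈-autPerms⁺ R idPerm (aut-id R)
  }

-- An element of prime order p forces p to divide the group order: left
-- multiplication by it acts freely with period p.
prime-order⇒∣order : ∀ {m} (G : FiniteGroup m) {p} → Prime p → ∀ {χ} → χ ∈L FiniteGroup.elements G →
  χ ≢ idPerm → pw χ p ≡ idPerm → p ∣ FiniteGroup.order G
prime-order⇒∣order G {p} p-prime {χ} χ∈ χ≢id χᵖ≡id = p∣length elements (record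
  { unique   = unique
  ; closed   = ·-closed χ∈
  ; periodic = λ {σ} _ → trans (iter-·≡pw χ p σ) (trans (cong (_· σ) χᵖ≡id) (·-identityˡ σ))
  ; moves    = λ {σ} _ e → χ≢id (·-cancel-id χ σ e)
  })
  where
  open FiniteGroup G
  open FreePrimeAction _≟P_ (χ ·_) p-prime

toList-onto : ∀ {A : Set} k (t : List A) → length t ≡ k → ∃ λ (v : Vec A k) → Vec.toList v ≡ t
toList-onto zero [] _ = [] , refl
toList-onto (suc k) (a ∷ t) e with toList-onto k t (suc-injective e)
... | v , refl = a ∷ v , refl

-- Cauchy's theorem (McKay's proof): if a prime p divides |G|, then G has an
-- element of order p.  The necklaces (g₁,…,gₚ) ∈ Gᵖ with g₁⋯gₚ = 1 number
-- |G|^(p-1), since g₁ is determined by the others.  Rotation permutes them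
-- with period p and fixes exactly the constant necklaces (g,…,g), i.e. the
-- g with gᵖ = 1.  If (1,…,1) were the only fixed one, the remaining
-- necklaces would form free orbits of size p, so p ∣ |G|^(p-1) - 1: absurd.
module Cauchy {m} (G : FiniteGroup m) {p} (p-prime : Prime p) (p∣order : p ∣ FiniteGroup.order G) where
  open FiniteGroup G

  private
    instance
      p-nonTrivial : ℕ.NonTrivial p
      p-nonTrivial = prime⇒nonTrivial p-prime
      p-nonZero : NonZero p
      p-nonZero = prime⇒nonZero p-prime

    _≟N_ : DecidableEquality (List (Perm m))
    _≟N_ = ≡-dec _≟P_

  prod : List (Perm m) → Perm m
  prod [] = idPerm
  prod (a ∷ t) = a · prod t

  prod-++ : ∀ xs ys → prod (xs ++ ys) ≡ prod xs · prod ys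
  prod-++ [] ys = sym (·-identityˡ _)
  prod-++ (x ∷ xs) ys = trans (cong (x ·_) (prod-++ xs ys)) (sym (·-assoc x (prod xs) (prod ys)))

  prod-closed : ∀ {t} → All (_∈L elements) t → prod t ∈L elements
  prod-closed [] = id∈
  prod-closed (a∈ ∷ t∈) = ·-closed a∈ (prod-closed t∈)

  prod-replicate : ∀ (a : Perm m) k → prod (replicate k a) ≡ pw a k
  prod-replicate a zero = refl
  prod-replicate a (suc k) = cong (a ·_) (prod-replicate a k)

  Necklace : List (Perm m) → Set
  Necklace x = length x ≡ p × All (_∈L elements) x × prod x ≡ idPerm

  close : List (Perm m) → List (Perm m)
  close t = invP (prod t) ∷ t

  necklaces : List (List (Perm m))
  necklaces = L.map (close ∘ Vec.toList) (tuples elements (p ∸ 1))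

  necklaces-sound : ∀ {x} → x ∈L necklaces → Necklace x
  necklaces-sound x∈ with ∈-map⁻ (close ∘ Vec.toList) x∈
  ... | v , v∈ , refl =
    trans (cong suc (length-toList v)) (suc-pred p) ,
    invP-closed (prod-closed v∈G) ∷ v∈G , ·-inverseˡ (prod (Vec.toList v))
    where
    v∈G : All (_∈L elements) (Vec.toList v)
    v∈G = ∈-tuples⁻ elements v v∈

  necklaces-complete : ∀ {x} → Necklace x → x ∈L necklaces
  necklaces-complete {[]} (len , _) = ⊥-elim (0≢1+n (trans len (sym (suc-pred p))))
  necklaces-complete {a ∷ t} (len , _ ∷ t∈G , prod≡id) with toList-onto (p ∸ 1) t (cong (_∸ 1) len)
  ... | v , refl = subst (_∈L necklaces) (cong (_∷ Vec.toList v) (sym (inverse-unique a (prod (Vec.toList v)) prod≡id)))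
    (∈-map⁺ (close ∘ Vec.toList) (∈-tuples⁺ elements v t∈G))

  necklaces-unique : Unique necklaces
  necklaces-unique = UP.map⁺ (λ e → trans (sym (VecP.cast-is-id refl _)) (VecP.toList-injective refl _ _ (∷-injectiveʳ e)))
    (tuples-unique elements unique (p ∸ 1))

  length-necklaces : length necklaces ≡ order ^ (p ∸ 1)
  length-necklaces = trans (length-map _ (tuples elements (p ∸ 1))) (length-tuples elements (p ∸ 1))

  -- Rotation preserves necklaces, as ab = 1 implies ba = 1.
  rotate-necklace : ∀ {x} → Necklace x → Necklace (rotate x)
  rotate-necklace {[]} n = n
  rotate-necklace {a ∷ t} (len , a∈ ∷ t∈ , prod≡id) =
    trans (length-rotate (a ∷ t)) len , AllP.++⁺ t∈ (a∈ ∷ []) ,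
    trans (prod-++ t [ a ]) (trans (cong (prod t ·_) (·-identityʳ a)) (·-inverse-swap a (prod t) prod≡id))

  trivial : List (Perm m)
  trivial = replicate p idPerm

  trivial-necklace : Necklace trivial
  trivial-necklace = length-replicate p , AllP.replicate⁺ p id∈ ,
    trans (prod-replicate idPerm p) (iter-fixed (idPerm ·_) (·-identityˡ idPerm) p)

  fixed-necklace : ∀ {x} → Necklace x → rotate x ≡ x → x ≢ trivial →
    ∃ λ χ → χ ∈L elements × χ ≢ idPerm × pw χ p ≡ idPerm
  fixed-necklace {[]} (len , _) _ _ = ⊥-elim (0≢1+n (trans len (sym (suc-pred p))))
  fixed-necklace {a ∷ t} (len , a∈ ∷ _ , prod≡id) rotated x≢trivial = a , a∈ , a≢id , aᵖ≡id
    where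
    constant : a ∷ t ≡ replicate p a
    constant = trans (cong (a ∷_) (rotate-fixed a t rotated)) (cong (λ k → replicate k a) len)
    a≢id : a ≢ idPerm
    a≢id refl = x≢trivial constant
    aᵖ≡id : pw a p ≡ idPerm
    aᵖ≡id = trans (sym (prod-replicate a p)) (trans (cong prod (sym constant)) prod≡id)

  only-trivial-fixed⇒⊥ : (∀ {x} → x ∈L necklaces → rotate x ≡ x → x ≡ trivial) → ⊥
  only-trivial-fixed⇒⊥ only-trivial = ℕ.nonTrivial⇒≢1 (∣1⇒≡1 p∣1)
    where
    open Counting _≟N_
    open FreePrimeAction _≟N_ rotate p-prime using (FreeOn; p∣length)

    nontrivial? : ∀ x → Dec (x ≢ trivial)
    nontrivial? x = ¬? (x ≟N trivial)

    others : List (List (Perm m))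
    others = filter nontrivial? necklaces

    periodic : ∀ {x} → x ∈L necklaces → iter rotate p x ≡ x
    periodic {x} x∈ = subst (λ k → iter rotate k x ≡ x) (proj₁ (necklaces-sound x∈)) (rotate-length x)

    -- x = rotate^(p-1) (rotate x), and rotation fixes the trivial necklace.
    rotate≢trivial : ∀ {x} → x ∈L necklaces → x ≢ trivial → rotate x ≢ trivial
    rotate≢trivial {x} x∈ x≢trivial rx≡trivial = x≢trivial (begin
      x                                  ≡⟨ sym (periodic x∈) ⟩
      iter rotate p x                    ≡⟨ cong (λ k → iter rotate k x) (sym (m∸n+n≡m (ℕ.>-nonZero⁻¹ p))) ⟩
      iter rotate (p ∸ 1 + 1) x          ≡⟨ iter-+ rotate (p ∸ 1) 1 x ⟩
      iter rotate (p ∸ 1) (rotate x)     ≡⟨ cong (iter rotate (p ∸ 1)) rx≡trivial ⟩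
      iter rotate (p ∸ 1) trivial        ≡⟨ iter-fixed rotate (rotate-replicate idPerm p) (p ∸ 1) ⟩
      trivial                            ∎)
      where open ≡-Reasoning

    others-free : FreeOn others
    others-free = record
      { unique   = UP.filter⁺ nontrivial? necklaces-unique
      ; closed   = λ x∈ → let (x∈N , x≢) = ∈-filter⁻ nontrivial? {xs = necklaces} x∈ in
          ∈-filter⁺ nontrivial? (necklaces-complete (rotate-necklace (necklaces-sound x∈N))) (rotate≢trivial x∈N x≢)
      ; periodic = λ x∈ → periodic (proj₁ (∈-filter⁻ nontrivial? {xs = necklaces} x∈))
      ; moves    = λ x∈ rx≡x → let (x∈N , x≢) = ∈-filter⁻ nontrivial? {xs = necklaces} x∈ in
          x≢ (only-trivial x∈N rx≡x)
      }

    length-necklaces≡1+others : length necklaces ≡ 1 + length others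
    length-necklaces≡1+others = trans (length-split (_≟N trivial) necklaces)
      (cong (_+ length others) (same-elements⇒same-length (UP.filter⁺ (_≟N trivial) necklaces-unique) ([] ∷ᵘ []ᵘ)
        (λ x∈ → here (proj₂ (∈-filter⁻ (_≟N trivial) {xs = necklaces} x∈)))
        (λ { (here refl) → ∈-filter⁺ (_≟N trivial) (necklaces-complete trivial-necklace) refl })))

    p∣necklaces : p ∣ length necklaces
    p∣necklaces = subst (p ∣_) (sym length-necklaces) (p∣power (p ∸ 1) (m<n⇒0<n∸m (ℕ.nonTrivial⇒n>1 p)))
      where
      p∣power : ∀ k → 0 < k → p ∣ order ^ k
      p∣power (suc k) _ = ∣m⇒∣m*n (order ^ k) p∣order

    p∣1 : p ∣ 1
    p∣1 = ∣m+n∣m⇒∣n (subst (p ∣_) (trans length-necklaces≡1+others (+-comm 1 (length others))) p∣necklaces)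
      (p∣length others others-free)

  cauchy : ∃ λ χ → χ ∈L elements × χ ≢ idPerm × pw χ p ≡ idPerm
  cauchy with Any.any? (λ x → (rotate x ≟N x) ×-dec ¬? (x ≟N trivial)) necklaces
  ... | yes found = let (x , x∈ , rotated , x≢trivial) = find found in
    fixed-necklace (necklaces-sound x∈) rotated x≢trivial
  ... | no none = ⊥-elim (only-trivial-fixed⇒⊥ λ {x} x∈ rotated →
    decidable-stable (x ≟N trivial) λ x≢trivial → none (lose x∈ (rotated , x≢trivial)))

cofactor-bounds : ∀ {d k p} → Prime p → 0 < d → d ≡ k * p → 0 < k × k < d
cofactor-bounds {d} {k} {p} p-prime 0<d d≡kp = n≢0⇒n>0 k≢0 ,
  subst (k <_) (sym d≡kp) (m<m*n k p {{ℕ.≢-nonZero k≢0}} (ℕ.nonTrivial⇒n>1 p {{prime⇒nonTrivial p-prime}}))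
  where
  k≢0 : k ≢ 0
  k≢0 refl = <-irrefl (sym d≡kp) 0<d

PrimeOrderPower : ∀ {m} → Perm m → ℕ → Set
PrimeOrderPower ψ d = ∃ λ p → Prime p × p ∣ d × ∃ λ k → pw ψ k ≢ idPerm × pw (pw ψ k) p ≡ idPerm

-- A permutation ψ ≠ 1 with ψᵈ = 1 (d > 0) has such a power: for a prime
-- factor p of d = k·p, either ψᵏ ≠ 1 has order p, or ψᵏ = 1 and we recurse
-- on k < d.
prime-order-power : ∀ {m} (ψ : Perm m) d → 0 < d → pw ψ d ≡ idPerm → ψ ≢ idPerm → PrimeOrderPower ψ d
prime-order-power {m} ψ = <-rec (λ d → 0 < d → pw ψ d ≡ idPerm → ψ ≢ idPerm → PrimeOrderPower ψ d) step
  where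
  step : ∀ d → (∀ {k} → k < d → 0 < k → pw ψ k ≡ idPerm → ψ ≢ idPerm → PrimeOrderPower ψ k) →
    0 < d → pw ψ d ≡ idPerm → ψ ≢ idPerm → PrimeOrderPower ψ d
  step (suc zero) _ _ ψ¹≡id ψ≢id = ⊥-elim (ψ≢id (trans (sym (·-identityʳ ψ)) ψ¹≡id))
  step d@(suc (suc _)) rec 0<d ψᵈ≡id ψ≢id with prime-factor d (s≤s (s≤s z≤n))
  ... | p , p-prime , divides k d≡kp with pw ψ k ≟P idPerm | cofactor-bounds p-prime 0<d d≡kp
  ...   | no ψᵏ≢id | _ = p , p-prime , divides k d≡kp , k , ψᵏ≢id ,
    trans (pw-* ψ k p) (trans (cong (pw ψ) (sym (trans d≡kp (*-comm k p)))) ψᵈ≡id)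
  ...   | yes ψᵏ≡id | 0<k , k<d with rec k<d 0<k ψᵏ≡id ψ≢id
  ...     | q , q-prime , q∣k , power = q , q-prime , ∣-trans q∣k (divides p (trans d≡kp (*-comm k p))) , power

_⟪_,_⟫ : ∀ {n h} → Profile n h → Perm h → Perm n → Profile n h
x ⟪ φ , ψ ⟫ = act x (φ , ψ , ωid)

module _ {n h : ℕ} where

  lookup-⟪⟫ : (x : Profile n h) (φ : Perm h) (ψ : Perm n) (i : Fin h) → lookup (x ⟪ φ , ψ ⟫) i ≡ ψ · lookup x (inv φ i)
  lookup-⟪⟫ x φ ψ i = trans (lookup∘tabulate _ i) (cong (ψ ·_) (·-identityʳ (lookup x (inv φ i))))

  ⟪⟫-comp : (x : Profile n h) (φ : Perm h) (ψ : Perm n) (φ′ : Perm h) (ψ′ : Perm n) → x ⟪ φ , ψ ⟫ ⟪ φ′ , ψ′ ⟫ ≡ x ⟪ φ′ · φ , ψ′ · ψ ⟫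
  ⟪⟫-comp x φ ψ φ′ ψ′ = vec-ext λ i → begin
    lookup (x ⟪ φ , ψ ⟫ ⟪ φ′ , ψ′ ⟫) i              ≡⟨ lookup-⟪⟫ (x ⟪ φ , ψ ⟫) φ′ ψ′ i ⟩
    ψ′ · lookup (x ⟪ φ , ψ ⟫) (inv φ′ i)            ≡⟨ cong (ψ′ ·_) (lookup-⟪⟫ x φ ψ (inv φ′ i)) ⟩
    ψ′ · (ψ · lookup x (inv φ (inv φ′ i)))          ≡⟨ sym (·-assoc ψ′ ψ (lookup x (inv φ (inv φ′ i)))) ⟩
    (ψ′ · ψ) · lookup x (inv φ (inv φ′ i))          ≡⟨ cong (λ j → (ψ′ · ψ) · lookup x j) (sym (inv-· φ′ φ i)) ⟩
    (ψ′ · ψ) · lookup x (inv (φ′ · φ) i)            ≡⟨ sym (lookup-⟪⟫ x (φ′ · φ) (ψ′ · ψ) i) ⟩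
    lookup (x ⟪ φ′ · φ , ψ′ · ψ ⟫) i                ∎ where open ≡-Reasoning

  ⟪⟫-id : (x : Profile n h) → x ⟪ idPerm , idPerm ⟫ ≡ x
  ⟪⟫-id x = vec-ext λ i → trans (lookup-⟪⟫ x idPerm idPerm i)
    (trans (·-identityˡ _) (cong (lookup x) (trans (cong (inv idPerm) (sym (app-id i))) (inv-l idPerm i))))

  ⟪⟫-inverse : (x : Profile n h) (φ : Perm h) (ψ : Perm n) → x ⟪ φ , ψ ⟫ ⟪ invP φ , invP ψ ⟫ ≡ x
  ⟪⟫-inverse x φ ψ = begin
    x ⟪ φ , ψ ⟫ ⟪ invP φ , invP ψ ⟫     ≡⟨ ⟪⟫-comp x φ ψ (invP φ) (invP ψ) ⟩
    x ⟪ invP φ · φ , invP ψ · ψ ⟫       ≡⟨ cong₂ (x ⟪_,_⟫) (·-inverseˡ φ) (·-inverseˡ ψ) ⟩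
    x ⟪ idPerm , idPerm ⟫               ≡⟨ ⟪⟫-id x ⟩
    x                                   ∎ where open ≡-Reasoning

  SetEqImage-trans : ∀ {X Y Z : LO n → Bool} (ψ : Perm n) → SetEqImage X ψ Y → SetEqImage Y idPerm Z → SetEqImage X ψ Z
  SetEqImage-trans {X} ψ (X⊆ψY , ψY⊆X) (Y⊆Z , Z⊆Y) =
    (λ q q∈ → let (q′ , q′∈ , q≡) = X⊆ψY q q∈ ; (q″ , q″∈ , q′≡) = Y⊆Z q′ q′∈ in
              q″ , q″∈ , trans q≡ (cong (ψ ·_) (trans q′≡ (·-identityˡ q″)))) ,
    (λ q q∈ → subst (λ t → (ψ · t) ∈ X) (·-identityˡ q) (ψY⊆X _ (Z⊆Y q q∈)))

  consistent-⟪⟫ : (R : Relation h) (Q : Relation n) (C : SPC n h) → Anonymous R C → Neutral Q C →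
    ∀ x (φ : Perm h) (ψ : Perm n) → InAut R (app φ) → InAut Q (app ψ) → SetEqImage (C (x ⟪ φ , ψ ⟫)) ψ (C x)
  consistent-⟪⟫ R Q C anon neut x φ ψ φ∈ ψ∈ = subst (λ y → SetEqImage (C y) ψ (C x)) split
    (SetEqImage-trans ψ (neut (x ⟪ φ , idPerm ⟫) (idPerm , ψ , ωid) (refl , ψ∈ , refl))
                        (anon x (φ , idPerm , ωid) (φ∈ , refl , refl)))
    where
    split : x ⟪ φ , idPerm ⟫ ⟪ idPerm , ψ ⟫ ≡ x ⟪ φ , ψ ⟫
    split = trans (⟪⟫-comp x φ idPerm idPerm ψ) (cong₂ (x ⟪_,_⟫) (·-identityˡ φ) (·-identityʳ ψ))

module _ {n h : ℕ} (x : Profile n h) (φ : Perm h) (ψ : Perm n) (fixed : x ⟪ φ , ψ ⟫ ≡ x) where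

  fixed-step : ∀ j → lookup x (app φ j) ≡ ψ · lookup x j
  fixed-step j = begin
    lookup x (app φ j)                  ≡⟨ cong (λ y → lookup y (app φ j)) (sym fixed) ⟩
    lookup (x ⟪ φ , ψ ⟫) (app φ j)      ≡⟨ lookup-⟪⟫ x φ ψ (app φ j) ⟩
    ψ · lookup x (inv φ (app φ j))      ≡⟨ cong (λ i → ψ · lookup x i) (inv-l φ j) ⟩
    ψ · lookup x j                      ∎ where open ≡-Reasoning

  fixed-iter : ∀ j k → lookup x (iter (app φ) k j) ≡ pw ψ k · lookup x j
  fixed-iter j zero = sym (·-identityˡ _)
  fixed-iter j (suc k) = trans (fixed-step _)
    (trans (cong (ψ ·_) (fixed-iter j k)) (sym (·-assoc ψ (pw ψ k) (lookup x j))))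

  -- Every orbit size of φ annihilates ψ (ψᵏ xⱼ = x_{φᵏ j} = xⱼ), hence so does their gcd.
  fixed⇒pw-gcdType : pw ψ (gcdType (app φ)) ≡ idPerm
  fixed⇒pw-gcdType = iter-gcd-fold (orbitSize (app φ)) (ψ ·_) (allFinL h) orbit-annihilates
    where
    orbit-annihilates : ∀ j → pw ψ (orbitSize (app φ) j) ≡ idPerm
    orbit-annihilates j = ·-cancel-id _ (lookup x j) (sym (begin
      lookup x j                                     ≡⟨ cong (lookup x) (sym period-returns) ⟩
      lookup x (iter (app φ) period j)               ≡⟨ cong (λ k → lookup x (iter (app φ) k j)) (sym orbitSize≡period) ⟩
      lookup x (iter (app φ) (orbitSize (app φ) j) j) ≡⟨ fixed-iter j (orbitSize (app φ) j) ⟩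
      pw ψ (orbitSize (app φ) j) · lookup x j        ∎))
      where
      open Period (app φ) (perm-injective φ) j
      open ≡-Reasoning

-- Conversely, if ψᵖ = 1 and p ∣ gcd T(φ), then some profile is fixed by
-- (φ, ψ): in each ⟨φ⟩-orbit pick a base point r, and let xᵢ = ψᶜ where c
-- steps of φ⁻¹ lead from i to r.  Different paths differ by a return time
-- of φ, a multiple of p, so the choice of c does not matter.
module FixedProfile {n h : ℕ} (φ : Perm h) (ψ : Perm n) {p : ℕ} (ψᵖ≡id : pw ψ p ≡ idPerm)
  (p∣gcdType : p ∣ gcdType (app φ)) where

  f : Fin h → Fin h
  f = inv φ

  f-inj : ∀ a b → f a ≡ f b → a ≡ b
  f-inj a b e = trans (sym (inv-r φ a)) (trans (cong (app φ) e) (inv-r φ b))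

  open Orbits f f-inj
  open Canonical (allFinL h) allFinL-complete Reach reach? reach-refl reach-sym reach-trans

  undo : ∀ k i → iter (app φ) k (iter f k i) ≡ i
  undo zero i = refl
  undo (suc k) i = trans (iter-suc (app φ) k _) (trans (cong (iter (app φ) k) (inv-r φ _)) (undo k i))

  p∣⇒pw≡id : ∀ k → p ∣ k → pw ψ k ≡ idPerm
  p∣⇒pw≡id k (divides q refl) = iter-* (ψ ·_) ψᵖ≡id q

  same-power-≤ : ∀ i a b → b ≤ a → iter f a i ≡ iter f b i → pw ψ a ≡ pw ψ b
  same-power-≤ i a b b≤a e = begin
    pw ψ a                  ≡⟨ cong (pw ψ) (sym (m∸n+n≡m b≤a)) ⟩
    pw ψ (a ∸ b + b)        ≡⟨ pw-+ ψ (a ∸ b) b ⟩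
    pw ψ (a ∸ b) · pw ψ b   ≡⟨ cong (_· pw ψ b) (p∣⇒pw≡id (a ∸ b) (∣-trans p∣gcdType (gcdType∣return φ i (a ∸ b) φ-returns))) ⟩
    idPerm · pw ψ b         ≡⟨ ·-identityˡ _ ⟩
    pw ψ b                  ∎
    where
    open ≡-Reasoning
    f-returns : iter f (a ∸ b) i ≡ i
    f-returns = iter-∸ f f-inj b≤a e
    φ-returns : iter (app φ) (a ∸ b) i ≡ i
    φ-returns = trans (cong (iter (app φ) (a ∸ b)) (sym f-returns)) (undo (a ∸ b) i)

  same-power : ∀ i a b → iter f a i ≡ iter f b i → pw ψ a ≡ pw ψ b
  same-power i a b e with ≤-total b a
  ... | inj₁ b≤a = same-power-≤ i a b b≤a e
  ... | inj₂ a≤b = sym (same-power-≤ i b a a≤b (sym e))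

  steps : Fin h → ℕ
  steps i = toℕ (proj₁ (canon-related i))

  steps-reach : ∀ i → iter f (steps i) i ≡ canon i
  steps-reach i = proj₂ (canon-related i)

  profile : Profile n h
  profile = tabulate (λ i → pw ψ (steps i))

  steps-f : ∀ i → iter f (suc (steps (f i))) i ≡ iter f (steps i) i
  steps-f i = begin
    iter f (suc (steps (f i))) i   ≡⟨ iter-suc f (steps (f i)) i ⟩
    iter f (steps (f i)) (f i)     ≡⟨ steps-reach (f i) ⟩
    canon (f i)                    ≡⟨ sym (canon-cong (reach 1 refl)) ⟩
    canon i                        ≡⟨ sym (steps-reach i) ⟩
    iter f (steps i) i             ∎ where open ≡-Reasoning

  profile-fixed : profile ⟪ φ , ψ ⟫ ≡ profile
  profile-fixed = vec-ext λ i → begin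
    lookup (profile ⟪ φ , ψ ⟫) i   ≡⟨ lookup-⟪⟫ profile φ ψ i ⟩
    ψ · lookup profile (f i)       ≡⟨ cong (ψ ·_) (lookup∘tabulate _ (f i)) ⟩
    pw ψ (suc (steps (f i)))       ≡⟨ same-power i (suc (steps (f i))) (steps i) (steps-f i) ⟩
    pw ψ (steps i)                 ≡⟨ sym (lookup∘tabulate _ i) ⟩
    lookup profile i               ∎ where open ≡-Reasoning

singleton : ∀ {n h} → (Profile n h → LO n) → SPC n h
singleton s x q = ⌊ q ≟P s x ⌋

module _ {n h : ℕ} (s : Profile n h → LO n) where

  ∈-singleton : ∀ x → s x ∈ singleton s x
  ∈-singleton x = fromWitness {a? = s x ≟P s x} refl

  singleton-∈ : ∀ x q → q ∈ singleton s x → q ≡ s x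
  singleton-∈ x q q∈ = toWitness {a? = q ≟P s x} q∈

  singleton-resolute : Resolute (singleton s)
  singleton-resolute x = s x , ∈-singleton x , singleton-∈ x

  singleton-refines : (C : SPC n h) → (∀ x → s x ∈ C x) → Refinement (singleton s) C
  singleton-refines C s∈C x q q∈ = subst (_∈ C x) (sym (singleton-∈ x q q∈)) (s∈C x)

  singleton-image : ∀ x y ψ → s y ≡ ψ · s x → SetEqImage (singleton s y) ψ (singleton s x)
  singleton-image x y ψ e =
    (λ q q∈ → s x , ∈-singleton x , trans (singleton-∈ y q q∈) e) ,
    (λ q q∈ → subst (λ t → (ψ · t) ∈ singleton s y) (sym (singleton-∈ x q q∈))
                (subst (_∈ singleton s y) e (∈-singleton y)))

-- A resolute consistent SPC cannot select at a profile fixed by (φ, ψ)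
-- unless ψ = 1, since its choice q would satisfy ψ q = q.
resolute-stabilizer : ∀ {n h} (R : Relation h) (Q : Relation n) (C : SPC n h) →
  Resolute C → Anonymous R C → Neutral Q C → ∀ x (φ : Perm h) (ψ : Perm n) →
  InAut R (app φ) → InAut Q (app ψ) → x ⟪ φ , ψ ⟫ ≡ x → ψ ≡ idPerm
resolute-stabilizer R Q C resolute anon neut x φ ψ φ∈ ψ∈ fixed with resolute x
... | q , q∈ , only-q = ·-cancel-id ψ q (only-q (ψ · q)
  (subst (λ y → (ψ · q) ∈ C y) fixed (proj₂ (consistent-⟪⟫ R Q C anon neut x φ ψ φ∈ ψ∈) q q∈)))

common-prime-factor : ∀ a b → b ≢ 0 → gcd a b ≢ 1 → ∃ λ p → Prime p × p ∣ a × p ∣ b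
common-prime-factor a b b≢0 g≢1 =
  let (p , p-prime , p∣g) = prime-factor (gcd a b) (2≤ (gcd a b) (gcd[m,n]≢0 a b (inj₂ b≢0)) g≢1)
  in p , p-prime , ∣-trans p∣g (gcd[m,n]∣m a b) , ∣-trans p∣g (gcd[m,n]∣n a b)
  where
  2≤ : ∀ k → k ≢ 0 → k ≢ 1 → 2 ≤ k
  2≤ zero k≢0 _ = ⊥-elim (k≢0 refl)
  2≤ (suc zero) _ k≢1 = ⊥-elim (k≢1 refl)
  2≤ (suc (suc _)) _ _ = s≤s (s≤s z≤n)

orderAut≢0 : ∀ {m} (R : Relation m) → orderAut R ≢ 0
orderAut≢0 R order≡0 = nonempty (∈-autPerms⁺ R idPerm (aut-id R)) (trans (length-autPerms R) order≡0)
  where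
  nonempty : ∀ {A : Set} {a : A} {xs} → a ∈L xs → length xs ≢ 0
  nonempty (here _) ()
  nonempty (there _) ()

-- If a prime p divides γ(Aut R) and |Aut Q|, pick φ ∈ Aut(R) with p ∣ gcd T(φ)
-- and ψ ∈ Aut(Q) of order p (Cauchy); some profile is fixed by (φ, ψ).
resolute⇒coprime : ∀ {n h} (R : Relation h) (Q : Relation n) (C : SPC n h) →
  Resolute C → Anonymous R C → Neutral Q C → gcd (typeNumberAut R) (orderAut Q) ≡ 1
resolute⇒coprime R Q C resolute anon neut =
  decidable-stable (gcd (typeNumberAut R) (orderAut Q) ℕ.≟ 1) no-common-prime
  where
  no-common-prime : ¬ (gcd (typeNumberAut R) (orderAut Q) ≢ 1)
  no-common-prime g≢1 with common-prime-factor _ _ (orderAut≢0 Q) g≢1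
  ... | p , p-prime , p∣γ , p∣order
    with prime∣typeNumber R p-prime p∣γ
       | Cauchy.cauchy (autGroup Q) p-prime (subst (p ∣_) (sym (length-autPerms Q)) p∣order)
  ... | φ , φ∈ , p∣gcdType | ψ , ψ∈ , ψ≢id , ψᵖ≡id =
    ψ≢id (resolute-stabilizer R Q C resolute anon neut profile φ ψ φ∈ (∈-autPerms⁻ Q ψ∈) profile-fixed)
    where open FixedProfile φ ψ ψᵖ≡id p∣gcdType

module Coprime {n h : ℕ} (R : Relation h) (Q : Relation n)
  (coprime : gcd (typeNumberAut R) (orderAut Q) ≡ 1) (i₀ : Fin h) where

  -- If (φ, ψ) fixes a profile then ψ^(gcdType φ) = 1; were ψ ≠ 1, a power
  -- of ψ of prime order p would make p divide both γ(Aut R) and |Aut Q|.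
  stabilizer-trivial : ∀ x (φ : Perm h) (ψ : Perm n) → InAut R (app φ) → InAut Q (app ψ) →
    x ⟪ φ , ψ ⟫ ≡ x → ψ ≡ idPerm
  stabilizer-trivial x φ ψ φ∈ ψ∈ fixed with ψ ≟P idPerm
  ... | yes ψ≡id = ψ≡id
  ... | no ψ≢id with prime-order-power ψ (gcdType (app φ)) (n≢0⇒n>0 (gcdType-nonZero φ i₀))
                       (fixed⇒pw-gcdType x φ ψ fixed) ψ≢id
  ... | p , p-prime , p∣d , k , χ≢id , χᵖ≡id =
    ⊥-elim (ℕ.nonTrivial⇒≢1 {{prime⇒nonTrivial p-prime}} (∣1⇒≡1 (subst (p ∣_) coprime (gcd-greatest p∣γ p∣order))))
    where
    p∣γ : p ∣ typeNumberAut R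
    p∣γ = ∣-trans p∣d (gcdType∣typeNumber R φ φ∈)
    p∣order : p ∣ orderAut Q
    p∣order = subst (p ∣_) (length-autPerms Q)
      (prime-order⇒∣order (autGroup Q) p-prime (∈-autPerms⁺ Q (pw ψ k) (aut-pw Q ψ ψ∈ k)) χ≢id χᵖ≡id)

  ψ-unique : ∀ x (a₁ : Perm h) (b₁ : Perm n) (a₂ : Perm h) (b₂ : Perm n) →
    InAut R (app a₁) → InAut Q (app b₁) → InAut R (app a₂) → InAut Q (app b₂) →
    x ⟪ a₁ , b₁ ⟫ ≡ x ⟪ a₂ , b₂ ⟫ → b₁ ≡ b₂
  ψ-unique x a₁ b₁ a₂ b₂ a₁∈ b₁∈ a₂∈ b₂∈ e = invP-·≡id⇒≡ b₁ b₂ (stabilizer-trivial x (invP a₂ · a₁) (invP b₂ · b₁)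
    (aut-· R (invP a₂) a₁ (aut-invP R a₂ a₂∈) a₁∈) (aut-· Q (invP b₂) b₁ (aut-invP Q b₂ b₂∈) b₁∈) (begin
      x ⟪ invP a₂ · a₁ , invP b₂ · b₁ ⟫         ≡⟨ sym (⟪⟫-comp x a₁ b₁ (invP a₂) (invP b₂)) ⟩
      x ⟪ a₁ , b₁ ⟫ ⟪ invP a₂ , invP b₂ ⟫       ≡⟨ cong (_⟪ invP a₂ , invP b₂ ⟫) e ⟩
      x ⟪ a₂ , b₂ ⟫ ⟪ invP a₂ , invP b₂ ⟫       ≡⟨ ⟪⟫-inverse x a₂ b₂ ⟩
      x                                         ∎))
    where open ≡-Reasoning

  pairs : List (Perm h × Perm n)
  pairs = cartesianProduct (autPerms R) (autPerms Q)

  _~_ : Profile n h → Profile n h → Set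
  x ~ y = Any (λ g → x ⟪ proj₁ g , proj₂ g ⟫ ≡ y) pairs

  _~?_ : ∀ x y → Dec (x ~ y)
  x ~? y = Any.any? (λ g → VecP.≡-dec _≟P_ (x ⟪ proj₁ g , proj₂ g ⟫) y) pairs

  ~-intro : ∀ x (a : Perm h) (b : Perm n) → InAut R (app a) → InAut Q (app b) → x ~ (x ⟪ a , b ⟫)
  ~-intro x a b a∈ b∈ = lose (∈-cartesianProduct⁺ (∈-autPerms⁺ R a a∈) (∈-autPerms⁺ Q b b∈)) refl

  Mover : Profile n h → Profile n h → Set
  Mover x y = Σ (Perm h × Perm n) λ (a , b) → InAut R (app a) × InAut Q (app b) × x ⟪ a , b ⟫ ≡ y

  ~-elim : ∀ {x y} → x ~ y → Mover x y
  ~-elim x~y with find x~y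
  ... | (a , b) , g∈ , e with ∈-cartesianProduct⁻ (autPerms R) (autPerms Q) g∈
  ... | a∈ , b∈ = (a , b) , ∈-autPerms⁻ R a∈ , ∈-autPerms⁻ Q b∈ , e

  ~-refl : ∀ {x} → x ~ x
  ~-refl {x} = subst (x ~_) (⟪⟫-id x) (~-intro x idPerm idPerm (aut-id R) (aut-id Q))

  ~-sym : ∀ {x y} → x ~ y → y ~ x
  ~-sym {x} x~y with ~-elim {x} x~y
  ... | (a , b) , a∈ , b∈ , refl = subst (x ⟪ a , b ⟫ ~_) (⟪⟫-inverse x a b)
    (~-intro (x ⟪ a , b ⟫) (invP a) (invP b) (aut-invP R a a∈) (aut-invP Q b b∈))

  ~-trans : ∀ {x y z} → x ~ y → y ~ z → x ~ z
  ~-trans {x} {y} x~y y~z with ~-elim {x} x~y | ~-elim {y} y~z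
  ... | (a , b) , a∈ , b∈ , refl | (a′ , b′) , a′∈ , b′∈ , refl = subst (x ~_) (sym (⟪⟫-comp x a b a′ b′))
    (~-intro x (a′ · a) (b′ · b) (aut-· R a′ a a′∈ a∈) (aut-· Q b′ b b′∈ b∈))

  allPerms : List (Perm n)
  allPerms = autPerms {n} (λ _ _ → Bool.true)

  ∈-allPerms : ∀ q → q ∈L allPerms
  ∈-allPerms q = ∈-autPerms⁺ _ q (λ _ _ → refl)

  open Canonical (tuples allPerms h) (λ x → ∈-tuples⁺ allPerms x (All.tabulate (λ _ → ∈-allPerms _)))
    _~_ _~?_ (λ {x} → ~-refl {x}) (λ {x} {y} → ~-sym {x} {y}) (λ {x} {y} {z} → ~-trans {x} {y} {z})

  module ToCanon (x : Profile n h) where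
    private
      w : Mover x (canon x)
      w = ~-elim {x} (canon-related x)
    a : Perm h
    a = proj₁ (proj₁ w)
    b : Perm n
    b = proj₂ (proj₁ w)
    a∈ : InAut R (app a)
    a∈ = proj₁ (proj₂ w)
    b∈ : InAut Q (app b)
    b∈ = proj₁ (proj₂ (proj₂ w))
    moved : x ⟪ a , b ⟫ ≡ canon x
    moved = proj₂ (proj₂ (proj₂ w))

  module Selection (C : SPC n h) (decisive : Decisive C) (anon : Anonymous R C) (neut : Neutral Q C) where

    opaque
      choose : Profile n h → LO n
      choose y = first (λ q → T? (C y q)) allPerms idPerm

      choose-∈ : ∀ y → choose y ∈ C y
      choose-∈ y = first-satisfies (λ q → T? (C y q)) allPerms idPerm
        (∈-allPerms (proj₁ (decisive y))) (proj₂ (decisive y))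

    select : Profile n h → LO n
    select x = invP (ToCanon.b x) · choose (canon x)

    select-∈ : ∀ x → select x ∈ C x
    select-∈ x = subst (λ y → select x ∈ C y) back
      (proj₂ (consistent-⟪⟫ R Q C anon neut (canon x) (invP a) (invP b) (aut-invP R a a∈) (aut-invP Q b b∈))
        (choose (canon x)) (choose-∈ (canon x)))
      where
      open ToCanon x
      back : canon x ⟪ invP a , invP b ⟫ ≡ x
      back = trans (cong (_⟪ invP a , invP b ⟫) (sym moved)) (⟪⟫-inverse x a b)

    -- By uniqueness of the Aut(Q)-part, the selection is Aut(R) × Aut(Q)-equivariant.
    select-equivariant : ∀ x (φ : Perm h) (ψ : Perm n) → InAut R (app φ) → InAut Q (app ψ) →
      select (x ⟪ φ , ψ ⟫) ≡ ψ · select x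
    select-equivariant x φ ψ φ∈ ψ∈ = begin
      invP b′ · choose (canon x′)            ≡⟨ cong (λ y → invP b′ · choose y) same-canon ⟩
      invP b′ · choose (canon x)             ≡⟨ cong (_· choose (canon x)) (invP-shift b′ ψ) ⟩
      (ψ · invP (b′ · ψ)) · choose (canon x) ≡⟨ cong (λ c → (ψ · invP c) · choose (canon x)) b′ψ≡b ⟩
      (ψ · invP b) · choose (canon x)        ≡⟨ ·-assoc ψ (invP b) (choose (canon x)) ⟩
      ψ · (invP b · choose (canon x))        ∎
      where
      open ≡-Reasoning
      x′ : Profile n h
      x′ = x ⟪ φ , ψ ⟫
      open ToCanon x
      open ToCanon x′ renaming (a to a′; b to b′; a∈ to a′∈; b∈ to b′∈; moved to moved′)
      same-canon : canon x′ ≡ canon x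
      same-canon = sym (canon-cong (~-intro x φ ψ φ∈ ψ∈))
      b′ψ≡b : b′ · ψ ≡ b
      b′ψ≡b = ψ-unique x (a′ · φ) (b′ · ψ) a b (aut-· R a′ φ a′∈ φ∈) (aut-· Q b′ ψ b′∈ ψ∈) a∈ b∈
        (trans (sym (⟪⟫-comp x φ ψ a′ b′)) (trans moved′ (trans same-canon (sym moved))))

    refinement : SPC n h
    refinement = singleton select

    refinement-anonymous : Anonymous R refinement
    refinement-anonymous x (φ , ψ , ρ) (φ∈ , refl , refl) =
      singleton-image select x _ idPerm (select-equivariant x φ idPerm φ∈ (aut-id Q))

    refinement-neutral : Neutral Q refinement
    refinement-neutral x (φ , ψ , ρ) (refl , ψ∈ , refl) =
      singleton-image select x _ ψ (select-equivariant x idPerm ψ (aut-id R) ψ∈)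

-- Theorem 17 (only h ≥ 1 is used: an individual makes every gcd T(φ) positive)

theorem17 : (n h : ℕ) → 2 ≤ n → 2 ≤ h →
    (R : Relation h) (Q : Relation n) (C : SPC n h) →
    Decisive C → Anonymous R C → Neutral Q C →
    (Σ (SPC n h) (λ C' → Refinement C' C × Resolute C' × Anonymous R C' × Neutral Q C'))
    ⇔ (gcd (typeNumberAut R) (orderAut Q) ≡ 1)
theorem17 n (suc h) _ (s≤s _) R Q C decisive anon neut = mk⇔ necessary sufficient
  where
  necessary : Σ (SPC n (suc h)) (λ C' → Refinement C' C × Resolute C' × Anonymous R C' × Neutral Q C') →
    gcd (typeNumberAut R) (orderAut Q) ≡ 1
  necessary (C' , _ , resolute , anon' , neut') = resolute⇒coprime R Q C' resolute anon' neut'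

  sufficient : gcd (typeNumberAut R) (orderAut Q) ≡ 1 →
    Σ (SPC n (suc h)) (λ C' → Refinement C' C × Resolute C' × Anonymous R C' × Neutral Q C')
  sufficient coprime = refinement ,
    singleton-refines select C select-∈ , singleton-resolute select , refinement-anonymous , refinement-neutral
    where open Coprime.Selection R Q coprime zero C decisive anon neut
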